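{- Let $k$ be a field of characteristic zero, $H$ the matroid Hopf algebra over $k$, and let $Q$ assign to every matroid $M$ a polynomial $Q_M(x,y,a,b)\in k[x,y,a,b]$, depending only on the isomorphism class of $M$, such that: (i) $Q_{M_1\oplus M_2}=Q_{M_1}Q_{M_2}$ for all matroids $M_1,M_2$, and $Q_{\mathbf 1}=1$ for the empty matroid; (ii) if $e$ is a coloop of $M$, then $Q_M=x\,Q_{M\backslash e}$; (iii) if $e$ is a loop of $M$, then $Q_M=y\,Q_{M/e}$; (iv) if $e$ is an element of $M$ that is neither a loop nor a coloop, then $Q_M=a\,Q_{M\backslash e}+b\,Q_{M/e}$. Let $K=k[x,y,a,b,s]$ and let $\beta:H\to K$ be the linear map with $\beta(M)=s^{|E|}Q_M(x,y,a,b)$ for every matroid $M=(E,\mathcal I)$. Then for every matroid $M$, $$\frac{d\beta}{ds}(M)=\Big(x\,\beta\ast\delta_{\mathrm{coloop}}+y\,\delta_{\mathrm{loop}}\ast\beta+b\,[\delta_{\mathrm{coloop}},\beta]_\ast-a\,[\delta_{\mathrm{loop}},\beta]_\ast\Big)(M),$$ where $\frac{d}{ds}$ is the formal derivative with respect to $s$.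
   Context: Matroids $M=(E,\mathcal I)$ on finite ground sets. A basis is a maximal independent set. An element $e$ is a loop if $\{e\}\notin\mathcal I$, and a coloop if it belongs to every basis. Deletion $M\backslash T$: matroid on $E-T$ with independent sets $\{I\in\mathcal I:I\subseteq E-T\}$; restriction $M|_A=M\backslash(E-A)$; dual $M^\star$: bases are complements of bases of $M$; contraction $M/T=(M^\star\backslash T)^\star$; $M\backslash e=M\backslash\{e\}$, $M/e=M/\{e\}$. Direct sum of matroids on disjoint ground sets: independent sets are unions $I_1\cup I_2$. $U_{r,n}$: uniform matroid on $n$ elements with independent sets the subsets of size $\le r$. The matroid Hopf algebra $H$ over $k$ has basis the isomorphism classes of matroids, product induced by direct sum, unit the empty matroid $\mathbf 1$, coproduct $\Delta(M)=\sum_{A\subseteq E}M|_A\otimes M/A$, counit $\epsilon(M)=1$ if $E=\emptyset$, else $0$. For linear $f,g:H\to K$, $(f\ast g)(M)=\sum_{A\subseteq E}f(M|_A)g(M/A)$ and $[f,g]_\ast=f\ast g-g\ast f$. $\delta_{\mathrm{loop}}(M)=1$ if $M\cong U_{0,1}$, else $0$; $\delta_{\mathrm{coloop}}(M)=1$ if $M\cong U_{1,1}$, else $0$ (extended linearly). -}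

module Defs where

open import Level using (Level; _⊔_) renaming (suc to lsuc)
open import Data.Bool using (Bool; true; false; _∧_; _∨_; not; if_then_else_; T)
open import Data.Nat as ℕ using (ℕ; zero; suc; _<_; _≡ᵇ_; _≤ᵇ_)
open import Data.Fin using (Fin)
open import Data.Fin.Properties using () renaming (_≟_ to _≟F_)
open import Data.Fin.Subset using (Subset; ⊥; ⁅_⁆; _∈_; _∉_; _⊆_; _∪_; _─_; ∣_∣)
open import Data.Vec as Vec using (Vec; []; _∷_; lookup; tabulate; take; drop; _++_)
open import Data.List as List using (List; []; _∷_; map; foldr; allFin)
open import Data.Bool.ListAction using (all; any)
open import Relation.Binary.PropositionalEquality using (_≡_)
open import Data.Product using (Σ; ∃; _×_; _,_)
open import Relation.Nullary using (¬_)
open import Relation.Nullary.Decidable using (⌊_⌋)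
open import Algebra.Bundles using (CommutativeRing)
open import Algebra.Bundles.Raw using (RawRing)

record Field (c ℓ : Level) : Set (lsuc (c ⊔ ℓ)) where
  field
    commutativeRing : CommutativeRing c ℓ
  open CommutativeRing commutativeRing public
  field
    1≉0     : ¬ (1# ≈ 0#)
    inverse : ∀ u → ¬ (u ≈ 0#) → ∃ λ v → u * v ≈ 1#

module _ {c ℓ} (R : RawRing c ℓ) where
  open RawRing R
  times : ℕ → Carrier → Carrier
  times zero    u = 0#
  times (suc n) u = u + times n u

CharZero : ∀ {c ℓ} → Field c ℓ → Set ℓ
CharZero k = ∀ n → ¬ (times rawRing (suc n) 1# ≈ 0#)
  where open Field k

-- Univariate polynomials over a raw ring: coefficient lists (constant
-- term first); equality = equality of all coefficients.

module _ {c ℓ} (R : RawRing c ℓ) where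
  open RawRing R

  coeff : List Carrier → ℕ → Carrier
  coeff []      i       = 0#
  coeff (u ∷ p) zero    = u
  coeff (u ∷ p) (suc i) = coeff p i

  addP : List Carrier → List Carrier → List Carrier
  addP []      q       = q
  addP (u ∷ p) []      = u ∷ p
  addP (u ∷ p) (v ∷ q) = (u + v) ∷ addP p q

  mulP : List Carrier → List Carrier → List Carrier
  mulP []      q = []
  mulP (u ∷ p) q = addP (map (u *_) q) (0# ∷ mulP p q)

  derivFrom : ℕ → List Carrier → List Carrier
  derivFrom n []      = []
  derivFrom n (u ∷ p) = times R n u ∷ derivFrom (suc n) p

  deriv : List Carrier → List Carrier
  deriv []      = []
  deriv (u ∷ p) = derivFrom 1 p

  Poly : RawRing c ℓ
  Poly = record
    { Carrier = List Carrier
    ; _≈_     = λ p q → ∀ i → coeff p i ≈ coeff q i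
    ; _+_     = addP
    ; _*_     = mulP
    ; -_      = map -_
    ; 0#      = []
    ; 1#      = 1# ∷ []
    }

  constP : Carrier → List Carrier
  constP u = u ∷ []

  varP : List Carrier
  varP = 0# ∷ 1# ∷ []

-- Matroids on a ground set E ⊆ Fin N (every finite matroid is
-- isomorphic to one of these).  Independence is Bool-valued
-- (decidable), as it is for any matroid on a finite set.

record RawMatroid (N : ℕ) : Set where
  constructor mkRawMatroid
  field
    ground : Subset N
    indep  : Subset N → Bool
open RawMatroid public

record IsMatroid {N : ℕ} (M : RawMatroid N) : Set where
  field
    indep⊆ground : ∀ I → T (indep M I) → I ⊆ ground M
    indep-empty  : T (indep M ⊥)
    indep-down   : ∀ I J → J ⊆ I → T (indep M I) → T (indep M J)
    indep-aug    : ∀ I J → T (indep M I) → T (indep M J) → ∣ I ∣ < ∣ J ∣ →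
                   ∃ λ e → e ∈ J × e ∉ I × T (indep M (I ∪ ⁅ e ⁆))

allSubsets : ∀ N → List (Subset N)
allSubsets zero    = [] ∷ []
allSubsets (suc N) = map (true ∷_) (allSubsets N) List.++ map (false ∷_) (allSubsets N)

_⊆ᵇ_ : ∀ {N} → Subset N → Subset N → Bool
[]      ⊆ᵇ []      = true
(u ∷ p) ⊆ᵇ (v ∷ q) = (not u ∨ v) ∧ (p ⊆ᵇ q)

_==ᵇ_ : ∀ {N} → Subset N → Subset N → Bool
[]      ==ᵇ []      = true
(u ∷ p) ==ᵇ (v ∷ q) = ((u ∧ v) ∨ (not u ∧ not v)) ∧ (p ==ᵇ q)

disjointᵇ : ∀ {N} → Subset N → Subset N → Bool
disjointᵇ []      []      = true
disjointᵇ (u ∷ p) (v ∷ q) = not (u ∧ v) ∧ disjointᵇ p q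

_⇔ᵇ_ : Bool → Bool → Bool
u ⇔ᵇ v = (u ∧ v) ∨ (not u ∧ not v)

isBasis : ∀ {N} → RawMatroid N → Subset N → Bool
isBasis {N} M B = indep M B ∧
  all (λ J → not (indep M J ∧ (B ⊆ᵇ J)) ∨ (J ==ᵇ B)) (allSubsets N)

IsBasis : ∀ {N} → RawMatroid N → Subset N → Set
IsBasis M B = T (isBasis M B)

_∖ˢ_ : ∀ {N} → RawMatroid N → Subset N → RawMatroid N
M ∖ˢ S = mkRawMatroid (ground M ─ S) (λ I → indep M I ∧ (I ⊆ᵇ (ground M ─ S)))

_∣ˢ_ : ∀ {N} → RawMatroid N → Subset N → RawMatroid N
M ∣ˢ A = M ∖ˢ (ground M ─ A)

-- Dual: bases are the complements (in E) of the bases of M; the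
-- independent sets are the subsets of those bases.
dual : ∀ {N} → RawMatroid N → RawMatroid N
dual {N} M = mkRawMatroid (ground M) (λ I → (I ⊆ᵇ ground M) ∧
  any (λ B → isBasis M B ∧ disjointᵇ I B) (allSubsets N))

_/ˢ_ : ∀ {N} → RawMatroid N → Subset N → RawMatroid N
M /ˢ S = dual (dual M ∖ˢ S)

_∖ₑ_ : ∀ {N} → RawMatroid N → Fin N → RawMatroid N
M ∖ₑ e = M ∖ˢ ⁅ e ⁆

_/ₑ_ : ∀ {N} → RawMatroid N → Fin N → RawMatroid N
M /ₑ e = M /ˢ ⁅ e ⁆

IsLoop : ∀ {N} → RawMatroid N → Fin N → Set
IsLoop M e = e ∈ ground M × ¬ T (indep M ⁅ e ⁆)

IsColoop : ∀ {N} → RawMatroid N → Fin N → Set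
IsColoop M e = e ∈ ground M × (∀ B → IsBasis M B → e ∈ B)

-- Direct sum (ground sets made disjoint by placing them side by side)
_⊕_ : ∀ {N₁ N₂} → RawMatroid N₁ → RawMatroid N₂ → RawMatroid (N₁ ℕ.+ N₂)
_⊕_ {N₁} M₁ M₂ = mkRawMatroid (ground M₁ ++ ground M₂)
  (λ I → indep M₁ (take N₁ I) ∧ indep M₂ (drop N₁ I))

emptyMatroid : RawMatroid 0
emptyMatroid = mkRawMatroid [] (λ _ → true)

image : ∀ {N N'} → (Fin N → Fin N') → Subset N → Subset N'
image {N} f I = tabulate (λ y → any (λ x → lookup I x ∧ ⌊ f x ≟F y ⌋) (allFin N))

record Iso {N N'} (M : RawMatroid N) (M' : RawMatroid N') : Set where
  field
    to      : Fin N → Fin N'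
    from    : Fin N' → Fin N
    to∈     : ∀ x → x ∈ ground M → to x ∈ ground M'
    from∈   : ∀ y → y ∈ ground M' → from y ∈ ground M
    from-to : ∀ x → x ∈ ground M → from (to x) ≡ x
    to-from : ∀ y → y ∈ ground M' → to (from y) ≡ y
    preserves : ∀ I → I ⊆ ground M → indep M I ≡ indep M' (image to I)

-- M ≅ U_{r,n}: |E| = n and the independent sets are exactly the
-- subsets of E of size ≤ r (U_{r,n} is invariant under all
-- permutations, so this is exactly isomorphism to U_{r,n}).
isUniform : ∀ {N} → ℕ → ℕ → RawMatroid N → Bool
isUniform {N} r n M = (∣ ground M ∣ ≡ᵇ n) ∧
  all (λ I → not (I ⊆ᵇ ground M) ∨ (indep M I ⇔ᵇ (∣ I ∣ ≤ᵇ r))) (allSubsets N)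

module Over {c ℓ} (k : Field c ℓ) where
  R₀ : RawRing c ℓ
  R₀ = Field.rawRing k

  -- k[x,y,a,b] = k[x][y][a][b]
  R₁ R₂ R₃ R₄ : RawRing c ℓ
  R₁ = Poly R₀
  R₂ = Poly R₁
  R₃ = Poly R₂
  R₄ = Poly R₃

  Kr : RawRing c ℓ
  Kr = Poly R₄

  open RawRing R₄ public using () renaming
    (Carrier to Kxyab; _≈_ to _≈xyab_; _+_ to _+xyab_; _*_ to _*xyab_; 1# to 1xyab)
  open RawRing Kr public using () renaming
    (Carrier to K; _≈_ to _≈K_; _+_ to _+K_; _*_ to _*K_; -_ to -K_; 0# to 0K; 1# to 1K)

  x y a b : Kxyab
  x = constP R₃ (constP R₂ (constP R₁ (varP R₀)))
  y = constP R₃ (constP R₂ (varP R₁))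
  a = constP R₃ (varP R₂)
  b = varP R₃

  s : K
  s = varP R₄

  ↑ : Kxyab → K
  ↑ = constP R₄

  _-K_ : K → K → K
  p -K q = p +K (-K q)

  _^K_ : K → ℕ → K
  p ^K zero    = 1K
  p ^K (suc n) = p *K (p ^K n)

  d/ds : K → K
  d/ds = deriv R₄

  -- linear maps H → K, given by their values on matroids
  HMap : Set c
  HMap = ∀ {N} → RawMatroid N → K

  sumK : List K → K
  sumK = foldr _+K_ 0K

  _⊛_ : HMap → HMap → HMap
  (f ⊛ g) {N} M = sumK (map (λ A → if A ⊆ᵇ ground M
                                     then f (M ∣ˢ A) *K g (M /ˢ A)
                                     else 0K) (allSubsets N))

  [_,_]⊛ : HMap → HMap → HMap
  [ f , g ]⊛ M = (f ⊛ g) M -K (g ⊛ f) M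

  δloop δcoloop : HMap
  δloop   M = if isUniform 0 1 M then 1K else 0K
  δcoloop M = if isUniform 1 1 M then 1K else 0K

  β : (∀ {N} → RawMatroid N → Kxyab) → HMap
  β Q M = (s ^K ∣ ground M ∣) *K ↑ (Q M)

module Submission where

-- Both sides are compared coefficientwise in s.  The coefficient of s^i in
-- dβ/ds(M) is (i+1) Q_M when |E| = i+1 and 0 otherwise, which is the sum
-- over e ∈ E of [|E| = i+1] Q_M.  On the right-hand side, a convolution
-- with δ_loop or δ_coloop only sees the subsets A for which M/A (resp.
-- M|_A) has one element, so (β ∗ δ_r)(M) and (δ_r ∗ β)(M) are sums over
-- e ∈ E of β(M \ e), resp. β(M / e), selected by whether e is a coloop,
-- resp. a loop.  For each e the combination of the four convolutions on the
-- right-hand side then reduces to the recurrence (ii)-(iv) for Q_M (using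
-- M / e ≅ M \ e when e is a loop or a coloop), times [|E| = i+1].

open import Defs
open import Level using (_⊔_)
import Data.Nat as Nat
open Nat using (ℕ; zero; suc; _≤_; _<_; s≤s; _≡ᵇ_; _≤ᵇ_)
import Data.Nat.Properties as ℕₚ
open ℕₚ using (suc-injective; ≤-trans; <⇒≱; m≤m+n; +-suc; +-monoʳ-≤; ≡ᵇ⇒≡)
open import Data.Bool using (Bool; true; false; T; not; _∧_; _∨_; if_then_else_)
open import Data.Bool.Properties using (T-∧; T-∨)
open import Data.Bool.ListAction using (all; any)
open import Data.Unit using (tt)
open import Data.Empty using () renaming (⊥-elim to absurd)
open import Data.Product using (∃; _×_; _,_; proj₁; proj₂)
open import Data.Sum using (_⊎_; inj₁; inj₂)
import Data.Fin as Fin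
open Fin using (Fin; zero; suc)
open import Data.Fin.Properties using () renaming (_≟_ to _≟F_)
open import Data.Fin.Subset using (Subset; ⁅_⁆; _─_; ∣_∣; _⊆_; _∈_; _∉_; _∪_) renaming (⊥ to ∅)
open import Data.Fin.Subset.Properties using (drop-∷-⊆; drop-there; ⊆-antisym; ⊆-refl; ⊆-trans; ⊥⊆; ∉⊥;
  x∈p∧x∉q⇒x∈p─q; x∈p∪q⁻; _∈?_; _⊆?_; p─⊥≡p; p─q⊆p; x∈⁅x⁆; x∈⁅y⁆⇒x≡y; x≢y⇒x∉⁅y⁆; ∣⁅x⁆∣≡1; ∣⊥∣≡0;
  ∣p∣≤n; p⊆q⇒∣p∣≤∣q∣)
open import Data.Vec using ([]; _∷_; here; there; lookup)
open import Data.Vec.Properties using (∷-injectiveʳ; tabulate∘lookup; tabulate-cong; lookup⇒[]=)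
open import Data.List as List using (List; []; _∷_; map; foldr; allFin)
open import Data.List.Properties using (map-++; map-∘)
import Data.List.Membership.Propositional as Listₘ
open import Data.List.Membership.Propositional.Properties using (∈-map⁺; ∈-++⁺ˡ; ∈-++⁺ʳ; ∈-allFin)
import Data.List.Relation.Unary.All as All
open import Data.List.Relation.Unary.All.Properties using (all⁺; all⁻)
open import Data.List.Relation.Unary.All.Properties.Core using (¬All⇒Any¬)
open import Data.List.Relation.Unary.Any as Any using (satisfied)
open import Data.List.Relation.Unary.Any.Properties using (any⁺; any⁻)
open import Function using (_∘_)
open import Function.Bundles using (module Equivalence)
open import Relation.Nullary using (¬_; yes; no)
open import Relation.Nullary.Decidable using (T?; ⌊_⌋; fromWitness)
import Relation.Binary.PropositionalEquality as ≡
open ≡ using (_≡_; _≢_)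
open import Algebra.Bundles using (CommutativeRing; NonAssociativeRing; AbelianGroup; CommutativeMonoid)
open import Algebra.Bundles.Raw using (RawRing)
open import Algebra.Structures using (IsNonAssociativeRing)

-- The ring axioms except associativity and commutativity of
-- multiplication.  They are exactly what coefficientwise computations
-- with polynomials need, and (unlike associativity) they transfer to
-- polynomial rings by a direct coefficient comparison.
IsNARing : ∀ {c ℓ} → RawRing c ℓ → Set (c ⊔ ℓ)
IsNARing R = IsNonAssociativeRing _≈_ _+_ _*_ -_ 0# 1#
  where open RawRing R

commutativeRing⇒IsNARing : ∀ {c ℓ} (R : CommutativeRing c ℓ) →
                           IsNARing (CommutativeRing.rawRing R)
commutativeRing⇒IsNARing R = record
  { +-isAbelianGroup = +-isAbelianGroup ; *-cong = *-cong
  ; *-identity = *-identity ; distrib = distrib ; zero = CommutativeRing.zero R }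
  where open CommutativeRing R hiding (zero)

module NARingProperties {c ℓ} (R : RawRing c ℓ) (laws : IsNARing R) where
  open RawRing R using (Carrier; _≈_; _+_; _*_; -_; 0#; 1#) public
  open IsNonAssociativeRing laws public hiding (zero)

  bundle : NonAssociativeRing c ℓ
  bundle = record { isNonAssociativeRing = laws }

  open AbelianGroup (NonAssociativeRing.+-abelianGroup bundle) public
    using () renaming (commutativeMonoid to +-commutativeMonoid)
  open import Algebra.Properties.AbelianGroup (NonAssociativeRing.+-abelianGroup bundle) public
    using (ε⁻¹≈ε; ⁻¹-involutive; ⁻¹-∙-comm; inverseʳ-unique)
  open import Algebra.Properties.CommutativeSemigroup
    (AbelianGroup.commutativeSemigroup (NonAssociativeRing.+-abelianGroup bundle)) public
    using (interchange)
  open import Relation.Binary.Reasoning.Setoid setoid public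

  -x*y : ∀ u v → u * (- v) ≈ - (u * v)
  -x*y u v = inverseʳ-unique (u * v) (u * (- v)) (begin
    u * v + u * (- v)  ≈⟨ distribˡ u v (- v) ⟨
    u * (v + - v)      ≈⟨ *-cong refl (-‿inverseʳ v) ⟩
    u * 0#             ≈⟨ zeroʳ u ⟩
    0#                 ∎)

  open import Algebra.Properties.CommutativeMonoid.Sum +-commutativeMonoid public
    using (sum; sum-cong-≋; ∑-distrib-+)

  ∑-scale : ∀ {n} u (f : Fin n → Carrier) → u * sum f ≈ sum (λ e → u * f e)
  ∑-scale {zero}  u f = zeroʳ u
  ∑-scale {suc n} u f = trans (distribˡ u _ _) (+-congˡ (∑-scale u (f ∘ Fin.suc)))

  ∑-neg : ∀ {n} (f : Fin n → Carrier) → - sum f ≈ sum (λ e → - f e)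
  ∑-neg {zero}  f = ε⁻¹≈ε
  ∑-neg {suc n} f = trans (sym (⁻¹-∙-comm _ _)) (+-congˡ (∑-neg (f ∘ Fin.suc)))

  [_]·_ : Bool → Carrier → Carrier
  [ b ]· u = if b then u else 0#

  []·-cong : ∀ b {u v} → (T b → u ≈ v) → [ b ]· u ≈ [ b ]· v
  []·-cong true  u≈v = u≈v tt
  []·-cong false _   = refl

  indicator-* : ∀ b u → (if b then 1# else 0#) * u ≈ [ b ]· u
  indicator-* true  u = *-identityˡ u
  indicator-* false u = zeroˡ u

  *-indicator : ∀ u b → u * (if b then 1# else 0#) ≈ [ b ]· u
  *-indicator u true  = *-identityʳ u
  *-indicator u false = zeroʳ u

  times-cong : ∀ n {u v} → u ≈ v → times R n u ≈ times R n v
  times-cong zero    _  = refl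
  times-cong (suc n) eq = +-cong eq (times-cong n eq)

  times-zero : ∀ n → times R n 0# ≈ 0#
  times-zero zero    = refl
  times-zero (suc n) = trans (+-congˡ (times-zero n)) (+-identityˡ 0#)

  times-count : ∀ {N} (E : Subset N) u → times R ∣ E ∣ u ≈ sum (λ e → [ lookup E e ]· u)
  times-count []          u = refl
  times-count (true ∷ E)  u = +-congˡ (times-count E u)
  times-count (false ∷ E) u = trans (times-count E u) (sym (+-identityˡ _))

  times-≡ᵇ : ∀ m n u → times R m ([ m ≡ᵇ n ]· u) ≈ times R n ([ m ≡ᵇ n ]· u)
  times-≡ᵇ m n u with m ≡ᵇ n in m≡ᵇn
  ... | false = trans (times-zero m) (sym (times-zero n))
  ... | true rewrite ≡ᵇ⇒≡ m n (≡.subst T (≡.sym m≡ᵇn) tt) = refl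

module Polynomials {c ℓ} (R : RawRing c ℓ) (laws : IsNARing R) where
  open NARingProperties R laws

  coeffOf : List Carrier → ℕ → Carrier
  coeffOf = coeff R

  _⋆_ : (ℕ → Carrier) → (ℕ → Carrier) → ℕ → Carrier
  (f ⋆ g) zero    = f 0 * g 0
  (f ⋆ g) (suc i) = f 0 * g (suc i) + ((f ∘ suc) ⋆ g) i

  ⋆-cong : ∀ {f f′ g g′} → (∀ j → f j ≈ f′ j) → (∀ j → g j ≈ g′ j) →
           ∀ i → (f ⋆ g) i ≈ (f′ ⋆ g′) i
  ⋆-cong f≈ g≈ zero    = *-cong (f≈ 0) (g≈ 0)
  ⋆-cong f≈ g≈ (suc i) = +-cong (*-cong (f≈ 0) (g≈ (suc i))) (⋆-cong (f≈ ∘ suc) g≈ i)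

  ⋆-zeroˡ : ∀ {f} g → (∀ j → f j ≈ 0#) → ∀ i → (f ⋆ g) i ≈ 0#
  ⋆-zeroˡ g f≈0 zero    = trans (*-cong (f≈0 0) refl) (zeroˡ _)
  ⋆-zeroˡ g f≈0 (suc i) = begin
    _ ≈⟨ +-cong (trans (*-cong (f≈0 0) refl) (zeroˡ _)) (⋆-zeroˡ g (f≈0 ∘ suc) i) ⟩
    0# + 0# ≈⟨ +-identityˡ 0# ⟩
    0# ∎

  ⋆-zeroʳ : ∀ f {g} → (∀ j → g j ≈ 0#) → ∀ i → (f ⋆ g) i ≈ 0#
  ⋆-zeroʳ f g≈0 zero    = trans (*-cong refl (g≈0 0)) (zeroʳ _)
  ⋆-zeroʳ f g≈0 (suc i) = begin
    _ ≈⟨ +-cong (trans (*-cong refl (g≈0 (suc i))) (zeroʳ _)) (⋆-zeroʳ (f ∘ suc) g≈0 i) ⟩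
    0# + 0# ≈⟨ +-identityˡ 0# ⟩
    0# ∎

  ⋆-distribˡ : ∀ f g h i → (f ⋆ (λ j → g j + h j)) i ≈ (f ⋆ g) i + (f ⋆ h) i
  ⋆-distribˡ f g h zero    = distribˡ _ _ _
  ⋆-distribˡ f g h (suc i) =
    trans (+-cong (distribˡ _ _ _) (⋆-distribˡ (f ∘ suc) g h i)) (interchange _ _ _ _)

  ⋆-distribʳ : ∀ f g h i → ((λ j → g j + h j) ⋆ f) i ≈ (g ⋆ f) i + (h ⋆ f) i
  ⋆-distribʳ f g h zero    = distribʳ _ _ _
  ⋆-distribʳ f g h (suc i) =
    trans (+-cong (distribʳ _ _ _) (⋆-distribʳ f (g ∘ suc) (h ∘ suc) i)) (interchange _ _ _ _)

  ⋆-constˡ : ∀ u g i → (coeffOf (constP R u) ⋆ g) i ≈ u * g i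
  ⋆-constˡ u g zero    = refl
  ⋆-constˡ u g (suc i) =
    trans (+-congˡ (⋆-zeroˡ g (λ _ → refl) i)) (+-identityʳ _)

  ⋆-constʳ : ∀ f u i → (f ⋆ coeffOf (constP R u)) i ≈ f i * u
  ⋆-constʳ f u zero    = refl
  ⋆-constʳ f u (suc i) =
    trans (+-cong (zeroʳ _) (⋆-constʳ (f ∘ suc) u i)) (+-identityˡ _)

  ⋆-varˡ : ∀ g i → (coeffOf (varP R) ⋆ g) (suc i) ≈ g i
  ⋆-varˡ g i = trans (+-cong (zeroˡ _) (⋆-constˡ 1# g i))
                     (trans (+-identityˡ _) (*-identityˡ _))

  ⋆-varˡ-zero : ∀ g → (coeffOf (varP R) ⋆ g) 0 ≈ 0#
  ⋆-varˡ-zero g = zeroˡ _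

  coeff-addP : ∀ p q i → coeffOf (addP R p q) i ≈ coeffOf p i + coeffOf q i
  coeff-addP []      q       i       = sym (+-identityˡ _)
  coeff-addP (u ∷ p) []      i       = sym (+-identityʳ _)
  coeff-addP (u ∷ p) (v ∷ q) zero    = refl
  coeff-addP (u ∷ p) (v ∷ q) (suc i) = coeff-addP p q i

  coeff-neg : ∀ p i → coeffOf (map -_ p) i ≈ - coeffOf p i
  coeff-neg []      i       = sym ε⁻¹≈ε
  coeff-neg (u ∷ p) zero    = refl
  coeff-neg (u ∷ p) (suc i) = coeff-neg p i

  coeff-scale : ∀ u q i → coeffOf (map (u *_) q) i ≈ u * coeffOf q i
  coeff-scale u []      i       = sym (zeroʳ u)
  coeff-scale u (v ∷ q) zero    = refl
  coeff-scale u (v ∷ q) (suc i) = coeff-scale u q i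

  coeff-mulP : ∀ p q i → coeffOf (mulP R p q) i ≈ (coeffOf p ⋆ coeffOf q) i
  coeff-mulP []      q i       = sym (⋆-zeroˡ (coeffOf q) (λ _ → refl) i)
  coeff-mulP (u ∷ p) q zero    = begin
    coeffOf (mulP R (u ∷ p) q) 0  ≈⟨ coeff-addP (map (u *_) q) (0# ∷ mulP R p q) 0 ⟩
    coeffOf (map (u *_) q) 0 + 0# ≈⟨ +-identityʳ _ ⟩
    coeffOf (map (u *_) q) 0      ≈⟨ coeff-scale u q 0 ⟩
    u * coeffOf q 0               ∎
  coeff-mulP (u ∷ p) q (suc i) =
    trans (coeff-addP (map (u *_) q) (0# ∷ mulP R p q) (suc i))
          (+-cong (coeff-scale u q (suc i)) (coeff-mulP p q i))

  _≋_ : List Carrier → List Carrier → Set ℓ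
  p ≋ q = ∀ i → coeffOf p i ≈ coeffOf q i

  addP-cong : ∀ {p p′ q q′} → p ≋ p′ → q ≋ q′ → addP R p q ≋ addP R p′ q′
  addP-cong {p} {p′} {q} {q′} p≈ q≈ i = begin
    coeffOf (addP R p q) i      ≈⟨ coeff-addP p q i ⟩
    coeffOf p i + coeffOf q i   ≈⟨ +-cong (p≈ i) (q≈ i) ⟩
    coeffOf p′ i + coeffOf q′ i ≈⟨ coeff-addP p′ q′ i ⟨
    coeffOf (addP R p′ q′) i    ∎

  addP-assoc : ∀ p q r → addP R (addP R p q) r ≋ addP R p (addP R q r)
  addP-assoc p q r i = begin
    coeffOf (addP R (addP R p q) r) i         ≈⟨ coeff-addP (addP R p q) r i ⟩
    coeffOf (addP R p q) i + coeffOf r i      ≈⟨ +-congʳ (coeff-addP p q i) ⟩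
    coeffOf p i + coeffOf q i + coeffOf r i   ≈⟨ +-assoc _ _ _ ⟩
    coeffOf p i + (coeffOf q i + coeffOf r i) ≈⟨ +-congˡ (coeff-addP q r i) ⟨
    coeffOf p i + coeffOf (addP R q r) i      ≈⟨ coeff-addP p (addP R q r) i ⟨
    coeffOf (addP R p (addP R q r)) i         ∎

  addP-comm : ∀ p q → addP R p q ≋ addP R q p
  addP-comm p q i = trans (coeff-addP p q i) (trans (+-comm _ _) (sym (coeff-addP q p i)))

  neg-cong : ∀ {p q} → p ≋ q → map -_ p ≋ map -_ q
  neg-cong {p} {q} p≈q i = trans (coeff-neg p i) (trans (-‿cong (p≈q i)) (sym (coeff-neg q i)))

  neg-inverseˡ : ∀ p → addP R (map -_ p) p ≋ []
  neg-inverseˡ p i = trans (coeff-addP (map -_ p) p i) (trans (+-congʳ (coeff-neg p i)) (-‿inverseˡ _))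

  neg-inverseʳ : ∀ p → addP R p (map -_ p) ≋ []
  neg-inverseʳ p i = trans (coeff-addP p (map -_ p) i) (trans (+-congˡ (coeff-neg p i)) (-‿inverseʳ _))

  mulP-cong : ∀ {p p′ q q′} → p ≋ p′ → q ≋ q′ → mulP R p q ≋ mulP R p′ q′
  mulP-cong {p} {p′} {q} {q′} p≈ q≈ i =
    trans (coeff-mulP p q i) (trans (⋆-cong p≈ q≈ i) (sym (coeff-mulP p′ q′ i)))

  mulP-distribˡ : ∀ p q r → mulP R p (addP R q r) ≋ addP R (mulP R p q) (mulP R p r)
  mulP-distribˡ p q r i = begin
    coeffOf (mulP R p (addP R q r)) i                     ≈⟨ coeff-mulP p (addP R q r) i ⟩
    (coeffOf p ⋆ coeffOf (addP R q r)) i                  ≈⟨ ⋆-cong (λ _ → refl) (coeff-addP q r) i ⟩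
    (coeffOf p ⋆ (λ j → coeffOf q j + coeffOf r j)) i     ≈⟨ ⋆-distribˡ (coeffOf p) _ _ i ⟩
    (coeffOf p ⋆ coeffOf q) i + (coeffOf p ⋆ coeffOf r) i ≈⟨ +-cong (coeff-mulP p q i) (coeff-mulP p r i) ⟨
    coeffOf (mulP R p q) i + coeffOf (mulP R p r) i       ≈⟨ coeff-addP (mulP R p q) (mulP R p r) i ⟨
    coeffOf (addP R (mulP R p q) (mulP R p r)) i          ∎

  mulP-distribʳ : ∀ p q r → mulP R (addP R q r) p ≋ addP R (mulP R q p) (mulP R r p)
  mulP-distribʳ p q r i = begin
    coeffOf (mulP R (addP R q r) p) i                     ≈⟨ coeff-mulP (addP R q r) p i ⟩
    (coeffOf (addP R q r) ⋆ coeffOf p) i                  ≈⟨ ⋆-cong (coeff-addP q r) (λ _ → refl) i ⟩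
    ((λ j → coeffOf q j + coeffOf r j) ⋆ coeffOf p) i     ≈⟨ ⋆-distribʳ (coeffOf p) _ _ i ⟩
    (coeffOf q ⋆ coeffOf p) i + (coeffOf r ⋆ coeffOf p) i ≈⟨ +-cong (coeff-mulP q p i) (coeff-mulP r p i) ⟨
    coeffOf (mulP R q p) i + coeffOf (mulP R r p) i       ≈⟨ coeff-addP (mulP R q p) (mulP R r p) i ⟨
    coeffOf (addP R (mulP R q p) (mulP R r p)) i          ∎

  polyLaws : IsNARing (Poly R)
  polyLaws = record
    { +-isAbelianGroup = record
      { isGroup = record
        { isMonoid = record
          { isSemigroup = record
            { isMagma = record
              { isEquivalence = record
                { refl = λ i → refl ; sym = λ p≈q i → sym (p≈q i)
                ; trans = λ p≈q q≈r i → trans (p≈q i) (q≈r i) }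
              ; ∙-cong = λ {p} {p′} {q} {q′} → addP-cong {p} {p′} {q} {q′} }
            ; assoc = addP-assoc }
          ; identity = (λ p i → refl) , (λ p i → trans (coeff-addP p [] i) (+-identityʳ _)) }
        ; inverse = neg-inverseˡ , neg-inverseʳ
        ; ⁻¹-cong = λ {p} {q} → neg-cong {p} {q} }
      ; comm = addP-comm }
    ; *-cong = λ {p} {p′} {q} {q′} → mulP-cong {p} {p′} {q} {q′}
    ; *-identity = (λ p i → trans (coeff-mulP (1# ∷ []) p i)
                                  (trans (⋆-constˡ 1# (coeffOf p) i) (*-identityˡ _)))
                 , (λ p i → trans (coeff-mulP p (1# ∷ []) i)
                                  (trans (⋆-constʳ (coeffOf p) 1# i) (*-identityʳ _)))
    ; distrib = mulP-distribˡ , mulP-distribʳ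
    ; zero = (λ p i → refl) , (λ p i → trans (coeff-mulP p [] i) (⋆-zeroʳ (coeffOf p) (λ _ → refl) i))
    }

  coeff-constMul : ∀ u p i → coeffOf (mulP R (constP R u) p) i ≈ u * coeffOf p i
  coeff-constMul u p i = trans (coeff-mulP (constP R u) p i) (⋆-constˡ u (coeffOf p) i)

  coeff-mulConst : ∀ p u i → coeffOf (mulP R p (constP R u)) i ≈ coeffOf p i * u
  coeff-mulConst p u i = trans (coeff-mulP p (constP R u) i) (⋆-constʳ (coeffOf p) u i)

  coeff-derivFrom : ∀ n p i → coeffOf (derivFrom R n p) i ≈ times R (n Nat.+ i) (coeffOf p i)
  coeff-derivFrom n []      i       = sym (times-zero (n Nat.+ i))
  coeff-derivFrom n (u ∷ p) zero    rewrite ℕₚ.+-identityʳ n = refl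
  coeff-derivFrom n (u ∷ p) (suc i) rewrite ℕₚ.+-suc n i = coeff-derivFrom (suc n) p i

  coeff-deriv : ∀ p i → coeffOf (deriv R p) i ≈ times R (suc i) (coeffOf p (suc i))
  coeff-deriv []      i = sym (times-zero (suc i))
  coeff-deriv (u ∷ p) i = coeff-derivFrom 1 p i

  private module Poly-R = NARingProperties (Poly R) polyLaws

  coeff-sum : ∀ {n} (f : Fin n → List Carrier) i → coeffOf (Poly-R.sum f) i ≈ sum (λ e → coeffOf (f e) i)
  coeff-sum {zero}  f i = refl
  coeff-sum {suc n} f i =
    trans (coeff-addP (f Fin.zero) (Poly-R.sum (f ∘ Fin.suc)) i) (+-congˡ (coeff-sum (f ∘ Fin.suc) i))

  coeff-[]· : ∀ b p i → coeffOf (Poly-R.[ b ]· p) i ≈ [ b ]· coeffOf p i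
  coeff-[]· true  p i = refl
  coeff-[]· false p i = refl

  coeff-sum-indicators : ∀ {n} (b₁ b₂ : Fin n → Bool) (p : Fin n → List Carrier) i →
    coeffOf (Poly-R.sum (λ e → Poly-R.[ b₁ e ]· (Poly-R.[ b₂ e ]· p e))) i ≈
    sum (λ e → [ b₁ e ]· ([ b₂ e ]· coeffOf (p e) i))
  coeff-sum-indicators b₁ b₂ p i = trans (coeff-sum (λ e → Poly-R.[ b₁ e ]· (Poly-R.[ b₂ e ]· p e)) i)
    (sum-cong-≋ (λ e → trans (coeff-[]· (b₁ e) (Poly-R.[ b₂ e ]· p e) i)
                             ([]·-cong (b₁ e) (λ _ → coeff-[]· (b₂ e) (p e) i))))

module BooleanTests where

  ∧-proj₁ : ∀ {a b} → T (a ∧ b) → T a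
  ∧-proj₁ = proj₁ ∘ Equivalence.to T-∧

  ∧-proj₂ : ∀ {a b} → T (a ∧ b) → T b
  ∧-proj₂ {a} = proj₂ ∘ Equivalence.to (T-∧ {a})

  ∧-intro : ∀ {a b} → T a → T b → T (a ∧ b)
  ∧-intro ta tb = Equivalence.from T-∧ (ta , tb)

  ⊆ᵇ-sound : ∀ {N} (p q : Subset N) → T (p ⊆ᵇ q) → p ⊆ q
  ⊆ᵇ-sound (true ∷ p) (true ∷ q) h here        = here
  ⊆ᵇ-sound (u ∷ p)    (v ∷ q)    h (there x∈p) = there (⊆ᵇ-sound p q (∧-proj₂ {not u ∨ v} h) x∈p)

  ⊆ᵇ-complete : ∀ {N} (p q : Subset N) → p ⊆ q → T (p ⊆ᵇ q)
  ⊆ᵇ-complete []          []      _   = tt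
  ⊆ᵇ-complete (false ∷ p) (v ∷ q) p⊆q = ⊆ᵇ-complete p q (drop-∷-⊆ p⊆q)
  ⊆ᵇ-complete (true ∷ p)  (v ∷ q) p⊆q with p⊆q here
  ... | here = ⊆ᵇ-complete p q (drop-∷-⊆ p⊆q)

  ==ᵇ-sound : ∀ {N} (p q : Subset N) → T (p ==ᵇ q) → p ≡ q
  ==ᵇ-sound []          []          _ = ≡.refl
  ==ᵇ-sound (true ∷ p)  (true ∷ q)  h = ≡.cong (true ∷_) (==ᵇ-sound p q h)
  ==ᵇ-sound (false ∷ p) (false ∷ q) h = ≡.cong (false ∷_) (==ᵇ-sound p q h)

  ==ᵇ-refl : ∀ {N} (p : Subset N) → T (p ==ᵇ p)
  ==ᵇ-refl []          = tt
  ==ᵇ-refl (true ∷ p)  = ==ᵇ-refl p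
  ==ᵇ-refl (false ∷ p) = ==ᵇ-refl p

  Disjoint : ∀ {N} → Subset N → Subset N → Set
  Disjoint p q = ∀ {x} → x ∈ p → x ∉ q

  disjointᵇ-sound : ∀ {N} (p q : Subset N) → T (disjointᵇ p q) → Disjoint p q
  disjointᵇ-sound (true ∷ p) (true ∷ q) ()
  disjointᵇ-sound (true ∷ p) (false ∷ q) h here ()
  disjointᵇ-sound (u ∷ p)    (v ∷ q)    h (there x∈p) x∈q =
    disjointᵇ-sound p q (∧-proj₂ {not (u ∧ v)} h) x∈p (drop-there x∈q)

  disjointᵇ-complete : ∀ {N} (p q : Subset N) → Disjoint p q → T (disjointᵇ p q)
  disjointᵇ-complete []          []          _    = tt
  disjointᵇ-complete (true ∷ p)  (true ∷ q)  p#q  = absurd (p#q here here)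
  disjointᵇ-complete (true ∷ p)  (false ∷ q) p#q  = disjointᵇ-complete p q (λ x∈p → p#q (there x∈p) ∘ there)
  disjointᵇ-complete (false ∷ p) (v ∷ q)     p#q  = disjointᵇ-complete p q (λ x∈p → p#q (there x∈p) ∘ there)

  ∈-allSubsets : ∀ {N} (A : Subset N) → A Listₘ.∈ allSubsets N
  ∈-allSubsets []                  = Any.here ≡.refl
  ∈-allSubsets {suc N} (true ∷ A)  = ∈-++⁺ˡ (∈-map⁺ (true ∷_) (∈-allSubsets A))
  ∈-allSubsets {suc N} (false ∷ A) =
    ∈-++⁺ʳ (map (true ∷_) (allSubsets N)) (∈-map⁺ (false ∷_) (∈-allSubsets A))

  all-subsets-sound : ∀ {N} (f : Subset N → Bool) → T (all f (allSubsets N)) → ∀ A → T (f A)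
  all-subsets-sound f h A = All.lookup (all⁺ f _ h) (∈-allSubsets A)

  all-subsets-complete : ∀ {N} (f : Subset N → Bool) → (∀ A → T (f A)) → T (all f (allSubsets N))
  all-subsets-complete {N} f h = all⁻ f {xs = allSubsets N} (All.tabulate (λ {A} _ → h A))

  all-subsets-counterexample : ∀ {N} (f : Subset N → Bool) → ¬ T (all f (allSubsets N)) →
                               ∃ λ A → ¬ T (f A)
  all-subsets-counterexample {N} f ¬all =
    satisfied (¬All⇒Any¬ (T? ∘ f) _ (¬all ∘ all⁻ f {xs = allSubsets N}))

  any-intro : ∀ {A : Set} (f : A → Bool) {x xs} → x Listₘ.∈ xs → T (f x) → T (any f xs)
  any-intro f x∈xs fx = any⁺ f (Listₘ.lose x∈xs fx)

  any-elim : ∀ {A : Set} (f : A → Bool) xs → T (any f xs) → ∃ λ x → T (f x)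
  any-elim f xs h = satisfied (any⁻ f xs h)

  ⇔ᵇ-true : ∀ b → (b ⇔ᵇ true) ≡ b
  ⇔ᵇ-true true  = ≡.refl
  ⇔ᵇ-true false = ≡.refl

  ⇔ᵇ-false : ∀ b → (b ⇔ᵇ false) ≡ not b
  ⇔ᵇ-false true  = ≡.refl
  ⇔ᵇ-false false = ≡.refl

  T⇒≡true : ∀ {b} → T b → b ≡ true
  T⇒≡true {true} _ = ≡.refl

  ¬T⇒≡false : ∀ {b} → ¬ T b → b ≡ false
  ¬T⇒≡false {false} _  = ≡.refl
  ¬T⇒≡false {true}  ¬b = absurd (¬b tt)

  T-ext : ∀ {a b} → (T a → T b) → (T b → T a) → a ≡ b
  T-ext {false} {false} _ _ = ≡.refl
  T-ext {false} {true}  _ g = absurd (g tt)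
  T-ext {true}  {false} f _ = absurd (f tt)
  T-ext {true}  {true}  _ _ = ≡.refl

module SubsetFacts where
  open BooleanTests

  ∈─⁻ : ∀ {N} {x : Fin N} (p q : Subset N) → x ∈ p ─ q → x ∈ p × x ∉ q
  ∈─⁻ (true ∷ p)  (false ∷ q) here        = here , λ ()
  ∈─⁻ {x = zero} (false ∷ p) (true ∷ q) ()
  ∈─⁻ {x = zero} (false ∷ p) (false ∷ q) ()
  ∈─⁻ (u ∷ p)     (v ∷ q)     (there x∈) with ∈─⁻ p q x∈
  ... | x∈p , x∉q = there x∈p , x∉q ∘ drop-there

  ── : ∀ {N} (E A : Subset N) → A ⊆ E → E ─ (E ─ A) ≡ A
  ── E A A⊆E = ⊆-antisym ⊆A A⊆
    where
    ⊆A : E ─ (E ─ A) ⊆ A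
    ⊆A {x} x∈ with ∈─⁻ E (E ─ A) x∈ | x ∈? A
    ... | _          | yes x∈A = x∈A
    ... | x∈E , x∉ | no x∉A  = absurd (x∉ (x∈p∧x∉q⇒x∈p─q x∈E x∉A))
    A⊆ : A ⊆ E ─ (E ─ A)
    A⊆ x∈A = x∈p∧x∉q⇒x∈p─q (A⊆E x∈A) (λ x∈E─A → proj₂ (∈─⁻ E A x∈E─A) x∈A)

  ∣─⁅⁆∣ : ∀ {N} (E : Subset N) {e} → e ∈ E → ∣ E ∣ ≡ suc ∣ E ─ ⁅ e ⁆ ∣
  ∣─⁅⁆∣ (true ∷ E)  here        = ≡.cong (suc ∘ ∣_∣) (≡.sym (p─⊥≡p E))
  ∣─⁅⁆∣ (true ∷ E)  (there e∈E) = ≡.cong suc (∣─⁅⁆∣ E e∈E)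
  ∣─⁅⁆∣ (false ∷ E) (there e∈E) = ∣─⁅⁆∣ E e∈E

  ⊆∧≢⇒∣∣< : ∀ {N} (I J : Subset N) → I ⊆ J → J ≢ I → ∣ I ∣ < ∣ J ∣
  ⊆∧≢⇒∣∣< []          []          _   J≢I = absurd (J≢I ≡.refl)
  ⊆∧≢⇒∣∣< (true ∷ I)  (v ∷ J)     I⊆J J≢I with I⊆J here
  ... | here = s≤s (⊆∧≢⇒∣∣< I J (drop-∷-⊆ I⊆J) (J≢I ∘ ≡.cong (true ∷_)))
  ⊆∧≢⇒∣∣< (false ∷ I) (true ∷ J)  I⊆J _   = s≤s (p⊆q⇒∣p∣≤∣q∣ (drop-∷-⊆ I⊆J))
  ⊆∧≢⇒∣∣< (false ∷ I) (false ∷ J) I⊆J J≢I = ⊆∧≢⇒∣∣< I J (drop-∷-⊆ I⊆J) (J≢I ∘ ≡.cong (false ∷_))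

  ⁅⁆⊆ : ∀ {N} {E : Subset N} {e} → e ∈ E → ⁅ e ⁆ ⊆ E
  ⁅⁆⊆ {E = E} e∈E x∈e = ≡.subst (_∈ E) (≡.sym (x∈⁅y⁆⇒x≡y _ x∈e)) e∈E

  ⊆⁅⁆ : ∀ {N} {e : Fin N} (I : Subset N) → I ⊆ ⁅ e ⁆ → I ≡ ∅ ⊎ I ≡ ⁅ e ⁆
  ⊆⁅⁆ {e = e} I I⊆e with e ∈? I
  ... | yes e∈I = inj₂ (⊆-antisym I⊆e (λ x∈e → ≡.subst (_∈ I) (≡.sym (x∈⁅y⁆⇒x≡y e x∈e)) e∈I))
  ... | no  e∉I = inj₁ (⊆-antisym (λ x∈I → absurd (e∉I (≡.subst (_∈ I) (x∈⁅y⁆⇒x≡y e (I⊆e x∈I)) x∈I))) ⊥⊆)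

  image-id : ∀ {N} (I : Subset N) → image (λ x → x) I ≡ I
  image-id {N} I = ≡.trans (tabulate-cong pointwise) (tabulate∘lookup I)
    where
    pointwise : ∀ y → any (λ x → lookup I x ∧ ⌊ x ≟F y ⌋) (allFin N) ≡ lookup I y
    pointwise y = T-ext to from
      where
      to : T (any (λ x → lookup I x ∧ ⌊ x ≟F y ⌋) (allFin N)) → T (lookup I y)
      to h with any-elim _ (allFin N) h
      ... | x , h′ with x ≟F y | ∧-proj₁ {lookup I x} h′ | ∧-proj₂ {lookup I x} h′
      ... | yes ≡.refl | Ix | _ = Ix
      ... | no _       | _  | ()
      from : T (lookup I y) → T (any (λ x → lookup I x ∧ ⌊ x ≟F y ⌋) (allFin N))
      from Iy = any-intro (λ x → lookup I x ∧ ⌊ x ≟F y ⌋) (∈-allFin y)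
                          (∧-intro Iy (fromWitness ≡.refl))

  ∣∣≡0⇒≡∅ : ∀ {N} (A : Subset N) → ∣ A ∣ ≡ 0 → A ≡ ∅
  ∣∣≡0⇒≡∅ []          _   = ≡.refl
  ∣∣≡0⇒≡∅ (false ∷ A) ∣A∣≡0 = ≡.cong (false ∷_) (∣∣≡0⇒≡∅ A ∣A∣≡0)

  ∣─∣≡0⇒≡ : ∀ {N} (E A : Subset N) → A ⊆ E → ∣ E ─ A ∣ ≡ 0 → A ≡ E
  ∣─∣≡0⇒≡ []          []          _   _ = ≡.refl
  ∣─∣≡0⇒≡ (true ∷ E)  (true ∷ A)  A⊆E h = ≡.cong (true ∷_) (∣─∣≡0⇒≡ E A (drop-∷-⊆ A⊆E) h)
  ∣─∣≡0⇒≡ (false ∷ E) (false ∷ A) A⊆E h = ≡.cong (false ∷_) (∣─∣≡0⇒≡ E A (drop-∷-⊆ A⊆E) h)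
  ∣─∣≡0⇒≡ (false ∷ E) (true ∷ A)  A⊆E h with A⊆E here
  ... | ()

-- Sums, indexed by the subsets of Fin N, of terms that vanish except on
-- a prescribed family of subsets; the convolution ∗ of the Hopf algebra
-- is such a sum whenever one factor is δ_loop or δ_coloop.
module SubsetSums {c ℓ} (M : CommutativeMonoid c ℓ) where
  open SubsetFacts using (∣∣≡0⇒≡∅; ∣─∣≡0⇒≡)
  open CommutativeMonoid M renaming (_∙_ to _+_; ε to 0#; ∙-cong to +-cong;
    identityˡ to +-identityˡ; identityʳ to +-identityʳ; assoc to +-assoc; comm to +-comm)
  open import Relation.Binary.Reasoning.Setoid setoid
  open import Algebra.Properties.CommutativeMonoid.Sum M using (sum; sum-cong-≋)

  sumₗ : List Carrier → Carrier
  sumₗ = foldr _+_ 0#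

  ΣSubsets : ∀ N → (Subset N → Carrier) → Carrier
  ΣSubsets N F = sumₗ (map F (allSubsets N))

  sumₗ-++ : ∀ xs ys → sumₗ (xs List.++ ys) ≈ sumₗ xs + sumₗ ys
  sumₗ-++ List.[]       ys = sym (+-identityˡ _)
  sumₗ-++ (x List.∷ xs) ys = trans (+-cong refl (sumₗ-++ xs ys)) (sym (+-assoc _ _ _))

  sumₗ-zero : ∀ {A : Set} (F : A → Carrier) xs → (∀ a → F a ≈ 0#) → sumₗ (map F xs) ≈ 0#
  sumₗ-zero F List.[]       F≈0 = refl
  sumₗ-zero F (x List.∷ xs) F≈0 = trans (+-cong (F≈0 x) (sumₗ-zero F xs F≈0)) (+-identityˡ _)

  ΣSubsets-zero : ∀ N F → (∀ A → F A ≈ 0#) → ΣSubsets N F ≈ 0#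
  ΣSubsets-zero N F = sumₗ-zero F (allSubsets N)

  ΣSubsets-split : ∀ N F → ΣSubsets (suc N) F ≈
                   ΣSubsets N (λ A → F (true ∷ A)) + ΣSubsets N (λ A → F (false ∷ A))
  ΣSubsets-split N F
    rewrite map-++ F (map (true ∷_) (allSubsets N)) (map (false ∷_) (allSubsets N))
          | ≡.sym (map-∘ {g = F} {f = true ∷_} (allSubsets N))
          | ≡.sym (map-∘ {g = F} {f = false ∷_} (allSubsets N))
    = sumₗ-++ (map (λ A → F (true ∷ A)) (allSubsets N)) (map (λ A → F (false ∷ A)) (allSubsets N))

  ΣSubsets-branches : ∀ N F {u v} → ΣSubsets N (λ A → F (true ∷ A)) ≈ u →
                      ΣSubsets N (λ A → F (false ∷ A)) ≈ v → ΣSubsets (suc N) F ≈ u + v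
  ΣSubsets-branches N F Σ₁≈u Σ₀≈v = trans (ΣSubsets-split N F) (+-cong Σ₁≈u Σ₀≈v)

  ΣSubsets-at : ∀ N (E : Subset N) F → (∀ A → A ≢ E → F A ≈ 0#) → ΣSubsets N F ≈ F E
  ΣSubsets-at zero    []          F F≈0 = +-identityʳ _
  ΣSubsets-at (suc N) (true ∷ E)  F F≈0 = trans
    (ΣSubsets-branches N F (ΣSubsets-at N E _ (λ A A≢E → F≈0 _ (A≢E ∘ ∷-injectiveʳ)))
                           (ΣSubsets-zero N _ (λ A → F≈0 _ (λ ()))))
    (+-identityʳ _)
  ΣSubsets-at (suc N) (false ∷ E) F F≈0 = trans
    (ΣSubsets-branches N F (ΣSubsets-zero N _ (λ A → F≈0 _ (λ ())))
                           (ΣSubsets-at N E _ (λ A A≢E → F≈0 _ (A≢E ∘ ∷-injectiveʳ))))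
    (+-identityˡ _)

  private
    zero∉ : ∀ {N} {E A : Subset N} → ¬ (true ∷ A ⊆ false ∷ E)
    zero∉ A⊆E with A⊆E here
    ... | ()

  ΣSubsets-singletons : ∀ N (E : Subset N) F → (∀ A → ¬ (A ⊆ E × ∣ A ∣ ≡ 1) → F A ≈ 0#) →
    ΣSubsets N F ≈ sum (λ e → if lookup E e then F ⁅ e ⁆ else 0#)
  ΣSubsets-singletons zero    []          F F≈0 = trans (+-identityʳ _) (F≈0 [] (λ { (_ , ()) }))
  ΣSubsets-singletons (suc N) (true ∷ E)  F F≈0 = ΣSubsets-branches N F
    (ΣSubsets-at N ∅ _ (λ A A≢∅ → F≈0 _ (λ (_ , ∣A∣+1≡1) → A≢∅ (∣∣≡0⇒≡∅ A (suc-injective ∣A∣+1≡1)))))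
    (ΣSubsets-singletons N E _ (λ A ¬A → F≈0 _ (λ (A⊆E , ∣A∣≡1) → ¬A (drop-∷-⊆ A⊆E , ∣A∣≡1))))
  ΣSubsets-singletons (suc N) (false ∷ E) F F≈0 = ΣSubsets-branches N F
    (ΣSubsets-zero N _ (λ A → F≈0 _ (zero∉ ∘ proj₁)))
    (ΣSubsets-singletons N E _ (λ A ¬A → F≈0 _ (λ (A⊆E , ∣A∣≡1) → ¬A (drop-∷-⊆ A⊆E , ∣A∣≡1))))

  ΣSubsets-cosingletons : ∀ N (E : Subset N) F → (∀ A → ¬ (A ⊆ E × ∣ E ─ A ∣ ≡ 1) → F A ≈ 0#) →
    ΣSubsets N F ≈ sum (λ e → if lookup E e then F (E ─ ⁅ e ⁆) else 0#)
  ΣSubsets-cosingletons zero    []          F F≈0 = trans (+-identityʳ _) (F≈0 [] (λ { (_ , ()) }))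
  ΣSubsets-cosingletons (suc N) (true ∷ E)  F F≈0 = begin
    ΣSubsets (suc N) F                       ≈⟨ ΣSubsets-branches N F
      (ΣSubsets-cosingletons N E _ (λ A ¬A → F≈0 _ (λ (A⊆E , h) → ¬A (drop-∷-⊆ A⊆E , h))))
      (ΣSubsets-at N E _ (λ A A≢E → F≈0 _ (λ (A⊆E , h) →
         A≢E (∣─∣≡0⇒≡ E A (drop-∷-⊆ A⊆E) (suc-injective h))))) ⟩
    rest + F (false ∷ E)                      ≈⟨ +-comm _ _ ⟩
    F (false ∷ E) + rest                      ≡⟨ ≡.cong (λ E′ → F (false ∷ E′) + rest) (p─⊥≡p E) ⟨
    F (false ∷ (E ─ ∅)) + rest                ∎
    where
    rest : Carrier
    rest = sum (λ e → if lookup E e then F (true ∷ (E ─ ⁅ e ⁆)) else 0#)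
  ΣSubsets-cosingletons (suc N) (false ∷ E) F F≈0 = ΣSubsets-branches N F
    (ΣSubsets-zero N _ (λ A → F≈0 _ (zero∉ ∘ proj₁)))
    (ΣSubsets-cosingletons N E _ (λ A ¬A → F≈0 _ (λ (A⊆E , h) → ¬A (drop-∷-⊆ A⊆E , h))))

module RawMatroids where
  open Nat using (_+_)
  open BooleanTests
  open SubsetFacts

  Indep : ∀ {N} → RawMatroid N → Subset N → Set
  Indep M I = T (indep M I)

  Maximal : ∀ {N} → RawMatroid N → Subset N → Set
  Maximal M B = ∀ J → Indep M J → B ⊆ J → J ≡ B

  private
    ⊆ᵇ-complete-≡ : ∀ {N} (p : Subset N) → (p ⊆ᵇ p) ≡ true
    ⊆ᵇ-complete-≡ p = T⇒≡true (⊆ᵇ-complete p p ⊆-refl)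

    ⇔ᵇ-intro : ∀ {a b} → T a → T b → T (a ⇔ᵇ b)
    ⇔ᵇ-intro {true} {true} _ _ = tt

    not-T : ∀ {b} → T (not b) → ¬ T b
    not-T {false} _ ()

    T-not : ∀ {b} → ¬ T b → T (not b)
    T-not {false} _  = tt
    T-not {true}  ¬b = absurd (¬b tt)

  module _ {N} (M : RawMatroid N) where

    basis⇒indep : ∀ {B} → IsBasis M B → Indep M B
    basis⇒indep = ∧-proj₁

    basis⇒maximal : ∀ {B} → IsBasis M B → Maximal M B
    basis⇒maximal {B} isB J iJ B⊆J
      with Equivalence.to T-∨ (all-subsets-sound _ (∧-proj₂ {indep M B} isB) J)
    ... | inj₁ ¬iJ∧B⊆J = absurd (not-T ¬iJ∧B⊆J (∧-intro iJ (⊆ᵇ-complete B J B⊆J)))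
    ... | inj₂ J=B     = ==ᵇ-sound J B J=B

    basis-intro : ∀ {B} → Indep M B → Maximal M B → IsBasis M B
    basis-intro {B} iB max = ∧-intro iB (all-subsets-complete _ test)
      where
      test : ∀ J → T (not (indep M J ∧ (B ⊆ᵇ J)) ∨ (J ==ᵇ B))
      test J with T? (indep M J ∧ (B ⊆ᵇ J))
      ... | no  ¬h = Equivalence.from T-∨ (inj₁ (T-not ¬h))
      ... | yes h  = Equivalence.from T-∨ (inj₂ (≡.subst (λ K → T (J ==ᵇ K))
                       (max J (∧-proj₁ h) (⊆ᵇ-sound B J (∧-proj₂ {indep M J} h))) (==ᵇ-refl J)))

    ¬basis⇒larger : ∀ {I} → Indep M I → ¬ IsBasis M I → ∃ λ J → Indep M J × I ⊆ J × J ≢ I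
    ¬basis⇒larger {I} iI ¬isB with all-subsets-counterexample _ (¬isB ∘ ∧-intro iI)
    ... | J , ¬test =
      J , ∧-proj₁ iJ∧I⊆J , ⊆ᵇ-sound I J (∧-proj₂ {indep M J} iJ∧I⊆J) ,
      λ J≡I → ¬test (Equivalence.from T-∨ (inj₂ (≡.subst (λ K → T (J ==ᵇ K)) J≡I (==ᵇ-refl J))))
      where
      iJ∧I⊆J : T (indep M J ∧ (I ⊆ᵇ J))
      iJ∧I⊆J with T? (indep M J ∧ (I ⊆ᵇ J))
      ... | yes h = h
      ... | no ¬h = absurd (¬test (Equivalence.from T-∨ (inj₁ (T-not ¬h))))

    -- every independent set extends to a basis (only finiteness is used)
    basis-extension : ∀ {I} → Indep M I → ∃ λ B → IsBasis M B × I ⊆ B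
    basis-extension {I} iI = extend N I (m≤m+n N ∣ I ∣) iI
      where
      extend : ∀ k I → N ≤ k + ∣ I ∣ → Indep M I → ∃ λ B → IsBasis M B × I ⊆ B
      extend k I bound iI with T? (isBasis M I)
      ... | yes isB = I , isB , ⊆-refl
      ... | no ¬isB with ¬basis⇒larger iI ¬isB
      ... | J , iJ , I⊆J , J≢I with k
      ... | zero  = absurd (<⇒≱ ∣I∣<∣J∣ (≤-trans (∣p∣≤n J) bound))
        where
        ∣I∣<∣J∣ : ∣ I ∣ < ∣ J ∣
        ∣I∣<∣J∣ = ⊆∧≢⇒∣∣< I J I⊆J J≢I
      ... | suc k with extend k J (≤-trans bound (≡.subst (_≤ k + ∣ J ∣) (+-suc k ∣ I ∣)
                                     (+-monoʳ-≤ k (⊆∧≢⇒∣∣< I J I⊆J J≢I)))) iJ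
      ... | B , isB , J⊆B = B , isB , ⊆-trans I⊆J J⊆B

  module _ {N} (M : RawMatroid N) where

    indep-deletion⁻ : ∀ S {I} → Indep (M ∖ˢ S) I → Indep M I × I ⊆ ground M ─ S
    indep-deletion⁻ S {I} h = ∧-proj₁ h , ⊆ᵇ-sound I _ (∧-proj₂ {indep M I} h)

    indep-deletion⁺ : ∀ S {I} → Indep M I → I ⊆ ground M ─ S → Indep (M ∖ˢ S) I
    indep-deletion⁺ S {I} iI I⊆ = ∧-intro iI (⊆ᵇ-complete I _ I⊆)

    indep-dual⁻ : ∀ {I} → Indep (dual M) I → I ⊆ ground M × ∃ λ B → IsBasis M B × Disjoint I B
    indep-dual⁻ {I} h with any-elim _ (allSubsets N) (∧-proj₂ {I ⊆ᵇ ground M} h)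
    ... | B , isB∧I#B = ⊆ᵇ-sound I (ground M) (∧-proj₁ h) , B , ∧-proj₁ isB∧I#B ,
                        disjointᵇ-sound I B (∧-proj₂ {isBasis M B} isB∧I#B)

    indep-dual⁺ : ∀ {I B} → I ⊆ ground M → IsBasis M B → Disjoint I B → Indep (dual M) I
    indep-dual⁺ {I} {B} I⊆E isB I#B = ∧-intro (⊆ᵇ-complete I (ground M) I⊆E)
      (any-intro (λ B′ → isBasis M B′ ∧ disjointᵇ I B′) (∈-allSubsets B)
                 (∧-intro isB (disjointᵇ-complete I B I#B)))

    ∅-indep-deletion : ∀ S → Indep M ∅ → Indep (M ∖ˢ S) ∅
    ∅-indep-deletion S i∅ = indep-deletion⁺ S i∅ ⊥⊆

    ∅-indep-dual : Indep M ∅ → Indep (dual M) ∅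
    ∅-indep-dual i∅ with basis-extension M i∅
    ... | B , isB , _ = indep-dual⁺ ⊥⊆ isB (λ x∈∅ → absurd (∉⊥ x∈∅))

  coloopTest : ∀ {N} → RawMatroid N → Fin N → Bool
  coloopTest M e = indep (M /ˢ (ground M ─ ⁅ e ⁆)) ⁅ e ⁆

  isUniform-singleton : ∀ {N} (X : RawMatroid N) {e} r → ground X ≡ ⁅ e ⁆ → Indep X ∅ →
                        isUniform r 1 X ≡ (indep X ⁅ e ⁆ ⇔ᵇ (1 ≤ᵇ r))
  isUniform-singleton {N} X {e} r E≡ i∅ rewrite E≡ | ∣⁅x⁆∣≡1 e = T-ext to from
    where
    test : Subset N → Bool
    test I = not (I ⊆ᵇ ⁅ e ⁆) ∨ (indep X I ⇔ᵇ (∣ I ∣ ≤ᵇ r))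
    to : T (all test (allSubsets N)) → T (indep X ⁅ e ⁆ ⇔ᵇ (1 ≤ᵇ r))
    to h with all-subsets-sound test h ⁅ e ⁆
    ... | t rewrite ⊆ᵇ-complete-≡ ⁅ e ⁆ | ∣⁅x⁆∣≡1 e = t
    from : T (indep X ⁅ e ⁆ ⇔ᵇ (1 ≤ᵇ r)) → T (all test (allSubsets N))
    from h = all-subsets-complete test tests
      where
      tests : ∀ I → T (test I)
      tests I with T? (I ⊆ᵇ ⁅ e ⁆)
      ... | no  I⊈e = Equivalence.from T-∨ (inj₁ (T-not I⊈e))
      ... | yes I⊆e with ⊆⁅⁆ I (⊆ᵇ-sound I ⁅ e ⁆ I⊆e)
      ... | inj₁ ≡.refl rewrite ∣⊥∣≡0 N | T⇒≡true i∅ = Equivalence.from T-∨ (inj₂ (⇔ᵇ-intro tt tt))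
      ... | inj₂ ≡.refl rewrite ∣⁅x⁆∣≡1 e = Equivalence.from (T-∨ {not (⁅ e ⁆ ⊆ᵇ ⁅ e ⁆)}) (inj₂ h)

  isUniform-size : ∀ {N} r n (X : RawMatroid N) → ∣ ground X ∣ ≢ n → isUniform r n X ≡ false
  isUniform-size {N} r n X ∣E∣≢n with T? (∣ ground X ∣ ≡ᵇ n)
  ... | yes h = absurd (∣E∣≢n (≡ᵇ⇒≡ _ n h))
  ... | no ¬h = ≡.cong (λ t → t ∧ all-test) (¬T⇒≡false ¬h)
    where
    all-test : Bool
    all-test = all (λ I → not (I ⊆ᵇ ground X) ∨ (indep X I ⇔ᵇ (∣ I ∣ ≤ᵇ r))) (allSubsets N)

module Matroids where
  open BooleanTests
  open SubsetFacts
  open RawMatroids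

  deletion-isMatroid : ∀ {N} {M : RawMatroid N} → IsMatroid M → ∀ S → IsMatroid (M ∖ˢ S)
  deletion-isMatroid {M = M} isM S = record
    { indep⊆ground = λ I h → proj₂ (indep-deletion⁻ M S h)
    ; indep-empty  = ∅-indep-deletion M S M.indep-empty
    ; indep-down   = λ I J J⊆I h → let iI , I⊆ = indep-deletion⁻ M S h in
                       indep-deletion⁺ M S (M.indep-down I J J⊆I iI) (⊆-trans J⊆I I⊆)
    ; indep-aug    = augment
    }
    where
    module M = IsMatroid isM
    augment : ∀ I J → Indep (M ∖ˢ S) I → Indep (M ∖ˢ S) J → ∣ I ∣ < ∣ J ∣ →
              ∃ λ x → x ∈ J × x ∉ I × Indep (M ∖ˢ S) (I ∪ ⁅ x ⁆)
    augment I J hI hJ ∣I∣<∣J∣ with indep-deletion⁻ M S hI | indep-deletion⁻ M S hJ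
    ... | iI , I⊆ | iJ , J⊆ with M.indep-aug I J iI iJ ∣I∣<∣J∣
    ... | x , x∈J , x∉I , iI+x = x , x∈J , x∉I , indep-deletion⁺ M S iI+x I+x⊆
      where
      I+x⊆ : I ∪ ⁅ x ⁆ ⊆ ground M ─ S
      I+x⊆ y∈ with x∈p∪q⁻ I ⁅ x ⁆ y∈
      ... | inj₁ y∈I = I⊆ y∈I
      ... | inj₂ y∈x = ⁅⁆⊆ (J⊆ x∈J) y∈x

  module _ {N} {M M′ : RawMatroid N} (E≡ : ground M ≡ ground M′)
           (I≡ : ∀ I → indep M I ≡ indep M′ I) where

    isMatroid-≗ : IsMatroid M → IsMatroid M′
    isMatroid-≗ isM = record
      { indep⊆ground = λ I h → ≡.subst (I ⊆_) E≡ (M.indep⊆ground I (from I h))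
      ; indep-empty  = to ∅ M.indep-empty
      ; indep-down   = λ I J J⊆I h → to J (M.indep-down I J J⊆I (from I h))
      ; indep-aug    = λ I J hI hJ lt → let x , x∈J , x∉I , h = M.indep-aug I J (from I hI) (from J hJ) lt
                                        in x , x∈J , x∉I , to (I ∪ ⁅ x ⁆) h
      }
      where
      module M = IsMatroid isM
      to : ∀ I → Indep M I → Indep M′ I
      to I = ≡.subst T (I≡ I)
      from : ∀ I → Indep M′ I → Indep M I
      from I = ≡.subst T (≡.sym (I≡ I))

    iso-≗ : Iso M M′
    iso-≗ = record
      { to = λ x → x ; from = λ x → x
      ; to∈ = λ x → ≡.subst (x ∈_) E≡ ; from∈ = λ x → ≡.subst (x ∈_) (≡.sym E≡)
      ; from-to = λ _ _ → ≡.refl ; to-from = λ _ _ → ≡.refl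
      ; preserves = λ I _ → ≡.trans (I≡ I) (≡.cong (indep M′) (≡.sym (image-id I)))
      }

  module _ {N} {M : RawMatroid N} (isM : IsMatroid M) where
    private module M = IsMatroid isM

    indep-down : ∀ {I J} → J ⊆ I → Indep M I → Indep M J
    indep-down {I} {J} = M.indep-down I J

    basis⊆ground : ∀ {B} → IsBasis M B → B ⊆ ground M
    basis⊆ground {B} = M.indep⊆ground B ∘ basis⇒indep M

    some-basis : ∃ (IsBasis M)
    some-basis = let B , isB , _ = basis-extension M M.indep-empty in B , isB

    loop⇒¬coloop : ∀ {e} → IsLoop M e → ¬ IsColoop M e
    loop⇒¬coloop (_ , ¬ie) (_ , e∈bases) =
      let B , isB = some-basis in ¬ie (indep-down (⁅⁆⊆ (e∈bases B isB)) (basis⇒indep M isB))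

    module Element {e : Fin N} (e∈E : e ∈ ground M) where
      E : Subset N
      E = ground M

      -- Z = M* \ e, so that M / e = Z*
      Z : RawMatroid N
      Z = dual M ∖ₑ e

      co : Subset N → Subset N
      co B = (E ─ B) ─ ⁅ e ⁆

      ∈co⁺ : ∀ {B x} → x ∈ E → x ∉ B → x ∉ ⁅ e ⁆ → x ∈ co B
      ∈co⁺ x∈E x∉B x∉e = x∈p∧x∉q⇒x∈p─q (x∈p∧x∉q⇒x∈p─q x∈E x∉B) x∉e

      ∈co⁻ : ∀ {B x} → x ∈ co B → x ∈ E ─ ⁅ e ⁆ × x ∉ B
      ∈co⁻ {B} x∈co = let x∈E─B , x∉e = ∈─⁻ (E ─ B) ⁅ e ⁆ x∈co
                          x∈E , x∉B = ∈─⁻ E B x∈E─B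
                      in x∈p∧x∉q⇒x∈p─q x∈E x∉e , x∉B

      co-indep : ∀ {B} → IsBasis M B → Indep Z (co B)
      co-indep {B} isB = indep-deletion⁺ (dual M) ⁅ e ⁆ {co B}
        (indep-dual⁺ M {co B} (p─q⊆p E ⁅ e ⁆ ∘ proj₁ ∘ ∈co⁻ {B}) isB (proj₂ ∘ ∈co⁻ {B})) (proj₁ ∘ ∈co⁻ {B})

      contraction⊆deletion : ∀ {I} → Indep (M /ₑ e) I → Indep (M ∖ₑ e) I
      contraction⊆deletion {I} h with indep-dual⁻ Z h
      ... | I⊆ , B′ , isB′ , I#B′ with indep-deletion⁻ (dual M) ⁅ e ⁆ (basis⇒indep Z isB′)
      ... | iB′ , B′⊆ with indep-dual⁻ M iB′
      ... | _ , B , isB , B′#B = indep-deletion⁺ M ⁅ e ⁆ (indep-down I⊆B (basis⇒indep M isB)) I⊆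
        where
        B′⊆co : B′ ⊆ co B
        B′⊆co x∈B′ = let x∈E , x∉e = ∈─⁻ E ⁅ e ⁆ (B′⊆ x∈B′) in ∈co⁺ x∈E (B′#B x∈B′) x∉e
        co≡B′ : co B ≡ B′
        co≡B′ = basis⇒maximal Z isB′ (co B) (co-indep isB) B′⊆co
        I⊆B : I ⊆ B
        I⊆B {x} x∈I with x ∈? B
        ... | yes x∈B = x∈B
        ... | no  x∉B = let x∈E , x∉e = ∈─⁻ E ⁅ e ⁆ (I⊆ x∈I) in
          absurd (I#B′ x∈I (≡.subst (x ∈_) co≡B′ (∈co⁺ x∈E x∉B x∉e)))

      deletion⊆contraction : IsLoop M e ⊎ IsColoop M e → ∀ {I} → Indep (M ∖ₑ e) I → Indep (M /ₑ e) I
      deletion⊆contraction loop⊎coloop {I} h with indep-deletion⁻ M ⁅ e ⁆ h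
      ... | iI , I⊆ with basis-extension M iI
      ... | B , isB , I⊆B = indep-dual⁺ Z I⊆ (basis-intro Z (co-indep isB) maximal) I#co
        where
        I#co : Disjoint I (co B)
        I#co x∈I x∈co = proj₂ (∈co⁻ x∈co) (I⊆B x∈I)
        maximal : Maximal Z (co B)
        maximal J iJ co⊆J with indep-deletion⁻ (dual M) ⁅ e ⁆ iJ
        ... | iJ* , J⊆ with indep-dual⁻ M iJ*
        ... | _ , B″ , isB″ , J#B″ = ⊆-antisym J⊆co co⊆J
          where
          -- a loop lies in no basis, a coloop in every basis
          e-stays : IsLoop M e ⊎ IsColoop M e → e ∈ B″ → e ∈ B
          e-stays (inj₁ (_ , ¬ie))     e∈B″ = absurd (¬ie (indep-down (⁅⁆⊆ e∈B″) (basis⇒indep M isB″)))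
          e-stays (inj₂ (_ , e∈bases)) _    = e∈bases B isB
          B″⊆B : B″ ⊆ B
          B″⊆B {x} x∈B″ with x ∈? B | x ≟F e
          ... | yes x∈B | _      = x∈B
          ... | no  x∉B | yes ≡.refl = absurd (x∉B (e-stays loop⊎coloop x∈B″))
          B″⊆B {x} x∈B″ | no x∉B | no x≢e =
            absurd (J#B″ (co⊆J (∈co⁺ (basis⊆ground isB″ x∈B″) x∉B (x≢y⇒x∉⁅y⁆ x≢e))) x∈B″)
          B≡B″ : B ≡ B″
          B≡B″ = basis⇒maximal M isB″ B (basis⇒indep M isB) B″⊆B
          J⊆co : J ⊆ co B
          J⊆co x∈J = let x∈E , x∉e = ∈─⁻ E ⁅ e ⁆ (J⊆ x∈J)
                     in ∈co⁺ x∈E (≡.subst (_ ∉_) (≡.sym B≡B″) (J#B″ x∈J)) x∉e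

      contraction≗deletion : IsLoop M e ⊎ IsColoop M e → ∀ I → indep (M /ₑ e) I ≡ indep (M ∖ₑ e) I
      contraction≗deletion loop⊎coloop I = T-ext contraction⊆deletion (deletion⊆contraction loop⊎coloop)

      E─E─e≡e : E ─ (E ─ ⁅ e ⁆) ≡ ⁅ e ⁆
      E─E─e≡e = ── E ⁅ e ⁆ (⁅⁆⊆ e∈E)

      e⊆E─E─e : ⁅ e ⁆ ⊆ E ─ (E ─ ⁅ e ⁆)
      e⊆E─E─e = ≡.subst (⁅ e ⁆ ⊆_) (≡.sym E─E─e≡e) ⊆-refl

      -- Y = M* \ (E - e), so that M / (E - e) = Y*
      Y : RawMatroid N
      Y = dual M ∖ˢ (E ─ ⁅ e ⁆)

      ∅-indepY : Indep Y ∅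
      ∅-indepY = ∅-indep-deletion (dual M) _ (∅-indep-dual M M.indep-empty)

      coloopTest⇒coloop : T (coloopTest M e) → IsColoop M e
      coloopTest⇒coloop h = e∈E , e∈bases
        where
        e∈bases : ∀ B → IsBasis M B → e ∈ B
        e∈bases B isB with e ∈? B
        ... | yes e∈B = e∈B
        ... | no  e∉B with indep-dual⁻ Y h
        ... | _ , B′ , isB′ , e#B′ = absurd (e#B′ (x∈⁅x⁆ e) (≡.subst (e ∈_) e≡B′ (x∈⁅x⁆ e)))
          where
          e-indepY : Indep Y ⁅ e ⁆
          e-indepY = indep-deletion⁺ (dual M) _
            (indep-dual⁺ M (⁅⁆⊆ e∈E) isB
                           (λ x∈e → ≡.subst (_∉ B) (≡.sym (x∈⁅y⁆⇒x≡y e x∈e)) e∉B))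
            e⊆E─E─e
          e≡B′ : ⁅ e ⁆ ≡ B′
          e≡B′ = basis⇒maximal Y isB′ ⁅ e ⁆ e-indepY
            (≡.subst (B′ ⊆_) E─E─e≡e (proj₂ (indep-deletion⁻ (dual M) _ (basis⇒indep Y isB′))))

      coloop⇒coloopTest : IsColoop M e → T (coloopTest M e)
      coloop⇒coloopTest (_ , e∈bases) = indep-dual⁺ Y e⊆E─E─e (basis-intro Y ∅-indepY maximal) (λ _ → ∉⊥)
        where
        maximal : Maximal Y ∅
        maximal J iJ _ with indep-deletion⁻ (dual M) _ iJ
        ... | iJ* , J⊆ with indep-dual⁻ M iJ* | ⊆⁅⁆ J (≡.subst (J ⊆_) E─E─e≡e J⊆)
        ... | _ , B , isB , J#B | inj₁ J≡∅ = J≡∅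
        ... | _ , B , isB , J#B | inj₂ J≡e =
          absurd (J#B (≡.subst (e ∈_) (≡.sym J≡e) (x∈⁅x⁆ e)) (e∈bases B isB))

      isUniform-restriction : ∀ r → isUniform r 1 (M ∣ˢ ⁅ e ⁆) ≡ (indep M ⁅ e ⁆ ⇔ᵇ (1 ≤ᵇ r))
      isUniform-restriction r = ≡.trans
        (isUniform-singleton (M ∣ˢ ⁅ e ⁆) r E─E─e≡e (∅-indep-deletion M _ M.indep-empty))
        (≡.cong (_⇔ᵇ (1 ≤ᵇ r))
                (T-ext (proj₁ ∘ indep-deletion⁻ M _) (λ ie → indep-deletion⁺ M _ ie e⊆E─E─e)))

      isUniform-contraction : ∀ r → isUniform r 1 (M /ˢ (E ─ ⁅ e ⁆)) ≡ (coloopTest M e ⇔ᵇ (1 ≤ᵇ r))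
      isUniform-contraction r = isUniform-singleton (M /ˢ (E ─ ⁅ e ⁆)) r E─E─e≡e (∅-indep-dual Y ∅-indepY)

-- Convolution with δ_loop and δ_coloop, for linear maps H → K into any
-- coefficient ring K: only the subsets A with M|_A or M/A on one element
-- contribute, and these are indexed by the elements e ∈ E.
module Convolution {c ℓ} (K : RawRing c ℓ) (laws : IsNARing K) where
  open BooleanTests using (⊆ᵇ-sound; ⊆ᵇ-complete; T⇒≡true)
  open SubsetFacts using (──; ⁅⁆⊆)
  open RawMatroids using (isUniform-size)
  open NARingProperties K laws
  open SubsetSums +-commutativeMonoid using (ΣSubsets; ΣSubsets-singletons; ΣSubsets-cosingletons)

  Linear : Set c
  Linear = ∀ {N} → RawMatroid N → Carrier

  _⊛_ : Linear → Linear → Linear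
  (f ⊛ g) {N} M = ΣSubsets N (λ A → [ A ⊆ᵇ ground M ]· (f (M ∣ˢ A) * g (M /ˢ A)))

  -- δ 0 = δ_loop and δ 1 = δ_coloop
  δ : ℕ → Linear
  δ r M = if isUniform r 1 M then 1# else 0#

  private
    outside : ∀ {N} (E A : Subset N) {u} → ¬ (A ⊆ E) → [ A ⊆ᵇ E ]· u ≈ 0#
    outside E A {u} A⊈E with A ⊆ᵇ E | ⊆ᵇ-sound A E
    ... | true  | sound = absurd (A⊈E (sound tt))
    ... | false | _     = refl

    inside : ∀ {N} (E A : Subset N) {u} → A ⊆ E → [ A ⊆ᵇ E ]· u ≈ u
    inside E A {u} A⊆E with A ⊆ᵇ E | ⊆ᵇ-complete A E A⊆E
    ... | true | _ = refl

    per-element : ∀ {N} (E : Subset N) (F G : Fin N → Carrier) → (∀ e → e ∈ E → F e ≈ G e) →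
                  sum (λ e → [ lookup E e ]· F e) ≈ sum (λ e → [ lookup E e ]· G e)
    per-element E F G F≈G =
      sum-cong-≋ (λ e → []·-cong (lookup E e) (F≈G e ∘ lookup⇒[]= e E ∘ T⇒≡true))

  ⊛-δʳ : ∀ r (f : Linear) {N} (M : RawMatroid N) → let E = ground M in
         (f ⊛ δ r) M ≈ sum (λ e → [ lookup E e ]· ([ isUniform r 1 (M /ˢ (E ─ ⁅ e ⁆)) ]· f (M ∖ₑ e)))
  ⊛-δʳ r f {N} M = trans (ΣSubsets-cosingletons N E _ vanish) (per-element E _ _ single)
    where
    E : Subset N
    E = ground M
    vanish : ∀ A → ¬ (A ⊆ E × ∣ E ─ A ∣ ≡ 1) → [ A ⊆ᵇ E ]· (f (M ∣ˢ A) * δ r (M /ˢ A)) ≈ 0#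
    vanish A ¬A with A ⊆? E
    ... | no  A⊈E = outside E A A⊈E
    ... | yes A⊆E rewrite isUniform-size r 1 (M /ˢ A) (λ ∣E─A∣≡1 → ¬A (A⊆E , ∣E─A∣≡1)) =
      trans (inside E A A⊆E) (zeroʳ _)
    single : ∀ e → e ∈ E → [ (E ─ ⁅ e ⁆) ⊆ᵇ E ]· (f (M ∣ˢ (E ─ ⁅ e ⁆)) * δ r (M /ˢ (E ─ ⁅ e ⁆))) ≈
                            [ isUniform r 1 (M /ˢ (E ─ ⁅ e ⁆)) ]· f (M ∖ₑ e)
    single e e∈E rewrite ── E ⁅ e ⁆ (⁅⁆⊆ e∈E) =
      trans (inside E (E ─ ⁅ e ⁆) (p─q⊆p E ⁅ e ⁆)) (*-indicator _ _)

  ⊛-δˡ : ∀ r (f : Linear) {N} (M : RawMatroid N) → let E = ground M in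
         (δ r ⊛ f) M ≈ sum (λ e → [ lookup E e ]· ([ isUniform r 1 (M ∣ˢ ⁅ e ⁆) ]· f (M /ₑ e)))
  ⊛-δˡ r f {N} M = trans (ΣSubsets-singletons N E _ vanish) (per-element E _ _ single)
    where
    E : Subset N
    E = ground M
    vanish : ∀ A → ¬ (A ⊆ E × ∣ A ∣ ≡ 1) → [ A ⊆ᵇ E ]· (δ r (M ∣ˢ A) * f (M /ˢ A)) ≈ 0#
    vanish A ¬A with A ⊆? E
    ... | no  A⊈E = outside E A A⊈E
    ... | yes A⊆E rewrite isUniform-size r 1 (M ∣ˢ A)
                            (λ ∣A∣≡1 → ¬A (A⊆E , ≡.trans (≡.cong ∣_∣ (≡.sym (── E A A⊆E))) ∣A∣≡1)) =
      trans (inside E A A⊆E) (zeroˡ _)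
    single : ∀ e → e ∈ E → [ ⁅ e ⁆ ⊆ᵇ E ]· (δ r (M ∣ˢ ⁅ e ⁆) * f (M /ˢ ⁅ e ⁆)) ≈
                            [ isUniform r 1 (M ∣ˢ ⁅ e ⁆) ]· f (M /ₑ e)
    single e e∈E = trans (inside E ⁅ e ⁆ (⁅⁆⊆ e∈E)) (indicator-* _ _)

-- The combination x t₁ + y u₀ + b (u₁ - t₁) - a (u₀ - t₀), which is the
-- coefficientwise shape of the right-hand side, and the recurrence
-- (ii)-(iv) according to whether e is a coloop, an ordinary element or a
-- loop.
module Combination {c ℓ} (R : RawRing c ℓ) (laws : IsNARing R) (x y a b : RawRing.Carrier R) where
  open NARingProperties R laws

  combination : Carrier → Carrier → Carrier → Carrier → Carrier
  combination t₁ u₀ u₁ t₀ = x * t₁ + y * u₀ + b * (u₁ + - t₁) + - (a * (u₀ + - t₀))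

  -- recurrence (coloop?) (independent {e}?) Q(M \ e) Q(M / e)
  recurrence : Bool → Bool → Carrier → Carrier → Carrier
  recurrence true  _     D C = x * D
  recurrence false true  D C = a * D + b * C
  recurrence false false D C = y * C

  recurrence-cong : ∀ c l {D D′ C C′} → D ≈ D′ → C ≈ C′ → recurrence c l D C ≈ recurrence c l D′ C′
  recurrence-cong true  _     D≈ C≈ = *-congˡ D≈
  recurrence-cong false true  D≈ C≈ = +-cong (*-congˡ D≈) (*-congˡ C≈)
  recurrence-cong false false D≈ C≈ = *-congˡ C≈

  private
    0-0 : 0# + - 0# ≈ 0#
    0-0 = -‿inverseʳ 0#

    *0 : ∀ u {v} → v ≈ 0# → u * v ≈ 0#
    *0 u v≈0 = trans (*-congˡ v≈0) (zeroʳ u)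

  combination-zero : ∀ {t₁ u₀ u₁ t₀} → t₁ ≈ 0# → u₀ ≈ 0# → u₁ ≈ 0# → t₀ ≈ 0# →
                     combination t₁ u₀ u₁ t₀ ≈ 0#
  combination-zero t₁≈0 u₀≈0 u₁≈0 t₀≈0 = begin
    x * _ + y * _ + b * (_ + - _) + - (a * (_ + - _))
      ≈⟨ +-cong (+-cong (+-cong (*0 x t₁≈0) (*0 y u₀≈0))
                        (*0 b (trans (+-cong u₁≈0 (-‿cong t₁≈0)) 0-0)))
                (-‿cong (*0 a (trans (+-cong u₀≈0 (-‿cong t₀≈0)) 0-0))) ⟩
    0# + 0# + 0# + - 0#  ≈⟨ +-cong (trans (+-congʳ (+-identityˡ 0#)) (+-identityˡ 0#)) ε⁻¹≈ε ⟩
    0# + 0#              ≈⟨ +-identityˡ 0# ⟩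
    0#                   ∎

  -- for a coloop t₀ = u₀ = 0, for a loop t₁ = u₁ = 0, otherwise t₁ = u₀ = 0;
  -- for loops and coloops D = Q(M \ e) and C = Q(M / e) agree
  combination-split : ∀ c l D C → (T c → T l) → (T c ⊎ ¬ T l → C ≈ D) →
    combination ([ c ]· D) ([ not l ]· C) ([ l ]· C) ([ not c ]· D) ≈ recurrence c l D C
  combination-split true  false D C c⇒l _   = absurd (c⇒l tt)
  combination-split true  true  D C _   C≈D = begin
    x * D + y * 0# + b * (C + - D) + - (a * (0# + - 0#))
      ≈⟨ +-cong (+-cong (+-congˡ (zeroʳ y)) (*0 b (trans (+-congʳ (C≈D (inj₁ tt))) (-‿inverseʳ D))))
                (-‿cong (*0 a 0-0)) ⟩
    x * D + 0# + 0# + - 0#  ≈⟨ +-cong (trans (+-identityʳ _) (+-identityʳ _)) ε⁻¹≈ε ⟩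
    x * D + 0#              ≈⟨ +-identityʳ _ ⟩
    x * D                   ∎
  combination-split false true  D C _   _   = begin
    x * 0# + y * 0# + b * (C + - 0#) + - (a * (0# + - D))
      ≈⟨ +-cong (+-cong (trans (+-cong (zeroʳ x) (zeroʳ y)) (+-identityˡ 0#))
                        (*-congˡ (trans (+-congˡ ε⁻¹≈ε) (+-identityʳ C))))
                (-‿cong (trans (*-congˡ (+-identityˡ _)) (-x*y a D))) ⟩
    0# + b * C + - - (a * D)  ≈⟨ +-cong (+-identityˡ _) (⁻¹-involutive _) ⟩
    b * C + a * D             ≈⟨ +-comm _ _ ⟩
    a * D + b * C             ∎
  combination-split false false D C _   C≈D = begin
    x * 0# + y * C + b * (0# + - 0#) + - (a * (C + - D))
      ≈⟨ +-cong (+-cong (+-congʳ (zeroʳ x)) (*0 b 0-0))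
                (-‿cong (*0 a (trans (+-congʳ (C≈D (inj₂ (λ ())))) (-‿inverseʳ D)))) ⟩
    0# + y * C + 0# + - 0#  ≈⟨ +-cong (trans (+-identityʳ _) (+-identityˡ _)) ε⁻¹≈ε ⟩
    y * C + 0#              ≈⟨ +-identityʳ _ ⟩
    y * C                   ∎

  combination-cong : ∀ {t₁ t₁′ u₀ u₀′ u₁ u₁′ t₀ t₀′} → t₁ ≈ t₁′ → u₀ ≈ u₀′ → u₁ ≈ u₁′ → t₀ ≈ t₀′ →
                     combination t₁ u₀ u₁ t₀ ≈ combination t₁′ u₀′ u₁′ t₀′
  combination-cong t₁≈ u₀≈ u₁≈ t₀≈ =
    +-cong (+-cong (+-cong (*-congˡ t₁≈) (*-congˡ u₀≈)) (*-congˡ (+-cong u₁≈ (-‿cong t₁≈))))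
           (-‿cong (*-congˡ (+-cong u₀≈ (-‿cong t₀≈))))

  combination-[]· : ∀ w t₁ u₀ u₁ t₀ →
    combination ([ w ]· t₁) ([ w ]· u₀) ([ w ]· u₁) ([ w ]· t₀) ≈ [ w ]· combination t₁ u₀ u₁ t₀
  combination-[]· true  _ _ _ _ = refl
  combination-[]· false _ _ _ _ = combination-zero refl refl refl refl

  recurrence-[]· : ∀ c l w D C → recurrence c l ([ w ]· D) ([ w ]· C) ≈ [ w ]· recurrence c l D C
  recurrence-[]· c     l     true  D C = refl
  recurrence-[]· true  l     false D C = zeroʳ x
  recurrence-[]· false true  false D C = trans (+-cong (zeroʳ a) (zeroʳ b)) (+-identityˡ 0#)
  recurrence-[]· false false false D C = zeroʳ y

  combination-∑ : ∀ {n} (f₁ f₂ f₃ f₄ : Fin n → Carrier) →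
    combination (sum f₁) (sum f₂) (sum f₃) (sum f₄) ≈ sum (λ e → combination (f₁ e) (f₂ e) (f₃ e) (f₄ e))
  combination-∑ f₁ f₂ f₃ f₄ = begin
    x * sum f₁ + y * sum f₂ + b * (sum f₃ + - sum f₁) + - (a * (sum f₂ + - sum f₄))
      ≈⟨ +-cong (+-cong (+-cong (∑-scale x f₁) (∑-scale y f₂)) (*-congˡ (difference f₃ f₁)))
                (-‿cong (*-congˡ (difference f₂ f₄))) ⟩
    sum (λ e → x * f₁ e) + sum (λ e → y * f₂ e) + b * sum (λ e → f₃ e + - f₁ e)
      + - (a * sum (λ e → f₂ e + - f₄ e))
      ≈⟨ +-cong (+-cong (sym (∑-distrib-+ (λ e → x * f₁ e) (λ e → y * f₂ e))) (∑-scale b g₁))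
                (trans (-‿cong (∑-scale a g₂)) (∑-neg (λ e → a * g₂ e))) ⟩
    sum (λ e → x * f₁ e + y * f₂ e) + sum (λ e → b * (f₃ e + - f₁ e))
      + sum (λ e → - (a * (f₂ e + - f₄ e)))
      ≈⟨ +-congʳ (sym (∑-distrib-+ (λ e → x * f₁ e + y * f₂ e) (λ e → b * g₁ e))) ⟩
    sum (λ e → x * f₁ e + y * f₂ e + b * (f₃ e + - f₁ e)) + sum (λ e → - (a * (f₂ e + - f₄ e)))
      ≈⟨ sym (∑-distrib-+ (λ e → x * f₁ e + y * f₂ e + b * g₁ e) (λ e → - (a * g₂ e))) ⟩
    sum (λ e → combination (f₁ e) (f₂ e) (f₃ e) (f₄ e)) ∎
    where
    g₁ g₂ : Fin _ → Carrier
    g₁ e = f₃ e + - f₁ e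
    g₂ e = f₂ e + - f₄ e
    difference : ∀ {n} (f g : Fin n → Carrier) → sum f + - sum g ≈ sum (λ e → f e + - g e)
    difference f g = trans (+-congˡ (∑-neg g)) (sym (∑-distrib-+ f (λ e → - g e)))

-- The theorem over an arbitrary coefficient ring R in place of k[x,y,a,b]:
-- for x y a b ∈ R and Q satisfying the isomorphism invariance and
-- (ii)-(iv), and for β(M) = s^|E| Q_M in R[s].
module DerivativeFormula {c ℓ} (R : RawRing c ℓ) (laws : IsNARing R) where
  open NARingProperties R laws
  open Polynomials R laws
    using (coeffOf; polyLaws; coeff-addP; coeff-neg; coeff-constMul; coeff-deriv; coeff-sum-indicators)
  open Convolution (Poly R) polyLaws using (Linear; _⊛_; δ; ⊛-δʳ; ⊛-δˡ)
  private module K = NARingProperties (Poly R) polyLaws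
  open BooleanTests using (⇔ᵇ-true; ⇔ᵇ-false; T⇒≡true)
  open SubsetFacts using (∣─⁅⁆∣)
  open RawMatroids using (coloopTest)
  open Matroids

  module _ (x y a b : Carrier) (Q : ∀ {N} → RawMatroid N → Carrier)
    (Q-iso : ∀ {N N′} (M : RawMatroid N) (M′ : RawMatroid N′) →
             IsMatroid M → IsMatroid M′ → Iso M M′ → Q M ≈ Q M′)
    (Q-coloop : ∀ {N} (M : RawMatroid N) (e : Fin N) → IsMatroid M → IsColoop M e →
                Q M ≈ (x * Q (M ∖ₑ e)))
    (Q-loop : ∀ {N} (M : RawMatroid N) (e : Fin N) → IsMatroid M → IsLoop M e →
              Q M ≈ (y * Q (M /ₑ e)))
    (Q-ordinary : ∀ {N} (M : RawMatroid N) (e : Fin N) → IsMatroid M → e ∈ ground M →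
                  ¬ IsLoop M e → ¬ IsColoop M e → Q M ≈ ((a * Q (M ∖ₑ e)) + (b * Q (M /ₑ e))))
    where
    open Combination R laws x y a b

    module _ {N} {M : RawMatroid N} (isM : IsMatroid M) {e : Fin N} (e∈E : e ∈ ground M) where
      open Element isM e∈E

      -- Q(M / e) = Q(M \ e) for a loop or coloop e, as then M / e ≅ M \ e
      Q-contraction≈deletion : IsLoop M e ⊎ IsColoop M e → Q (M /ₑ e) ≈ Q (M ∖ₑ e)
      Q-contraction≈deletion loop⊎coloop = sym (Q-iso (M ∖ₑ e) (M /ₑ e) isM\e
        (isMatroid-≗ ≡.refl same-indep isM\e) (iso-≗ ≡.refl same-indep))
        where
        isM\e : IsMatroid (M ∖ₑ e)
        isM\e = deletion-isMatroid isM ⁅ e ⁆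
        same-indep : ∀ I → indep (M ∖ₑ e) I ≡ indep (M /ₑ e) I
        same-indep I = ≡.sym (contraction≗deletion loop⊎coloop I)

      Q-recurrence : Q M ≈ recurrence (coloopTest M e) (indep M ⁅ e ⁆) (Q (M ∖ₑ e)) (Q (M /ₑ e))
      Q-recurrence with coloopTest M e in col | indep M ⁅ e ⁆ in ind
      ... | true  | _     = Q-coloop M e isM (coloopTest⇒coloop (≡.subst T (≡.sym col) tt))
      ... | false | true  = Q-ordinary M e isM e∈E (λ (_ , ¬ie) → ¬ie (≡.subst T (≡.sym ind) tt))
                                                    (λ coloop → ≡.subst T col (coloop⇒coloopTest coloop))
      ... | false | false = Q-loop M e isM (e∈E , ≡.subst T ind)

      -- a coloop is not a loop
      coloopTest⇒indep : T (coloopTest M e) → T (indep M ⁅ e ⁆)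
      coloopTest⇒indep h with T? (indep M ⁅ e ⁆)
      ... | yes ie = ie
      ... | no ¬ie = absurd (loop⇒¬coloop isM (e∈E , ¬ie) (coloopTest⇒coloop h))

    ↑ : Carrier → List Carrier
    ↑ = constP R

    -- β(M) = s^|E| Q_M, coefficientwise
    Homogeneous : Linear → Set ℓ
    Homogeneous β = ∀ {N} (M : RawMatroid N) j → coeffOf (β M) j ≈ [ j ≡ᵇ ∣ ground M ∣ ]· Q M

    rhs : Linear → Linear
    rhs β M = ((↑ x K.* (β ⊛ δ 1) M K.+ ↑ y K.* (δ 0 ⊛ β) M)
                K.+ ↑ b K.* ((δ 1 ⊛ β) M K.+ K.- (β ⊛ δ 1) M))
                K.+ K.- (↑ a K.* ((δ 0 ⊛ β) M K.+ K.- (β ⊛ δ 0) M))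

    coeff-rhs : ∀ (β : Linear) {N} (M : RawMatroid N) i → coeffOf (rhs β M) i ≈
      combination (coeffOf ((β ⊛ δ 1) M) i) (coeffOf ((δ 0 ⊛ β) M) i)
                  (coeffOf ((δ 1 ⊛ β) M) i) (coeffOf ((β ⊛ δ 0) M) i)
    coeff-rhs β M i =
      trans (coeff-difference (X₁ K.+ X₂ K.+ X₃) X₄)
        (+-cong (trans (coeff-addP (X₁ K.+ X₂) X₃ i)
                  (+-cong (trans (coeff-addP X₁ X₂ i)
                                 (+-cong (coeff-constMul x C₁ i) (coeff-constMul y C₂ i)))
                          (trans (coeff-constMul b (C₃ K.+ K.- C₁) i) (*-congˡ (coeff-difference C₃ C₁)))))
                (-‿cong (trans (coeff-constMul a (C₂ K.+ K.- C₄) i) (*-congˡ (coeff-difference C₂ C₄)))))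
      where
      C₁ C₂ C₃ C₄ X₁ X₂ X₃ X₄ : List Carrier
      C₁ = (β ⊛ δ 1) M
      C₂ = (δ 0 ⊛ β) M
      C₃ = (δ 1 ⊛ β) M
      C₄ = (β ⊛ δ 0) M
      X₁ = ↑ x K.* C₁
      X₂ = ↑ y K.* C₂
      X₃ = ↑ b K.* (C₃ K.+ K.- C₁)
      X₄ = ↑ a K.* (C₂ K.+ K.- C₄)
      coeff-difference : ∀ p q → coeffOf (p K.+ K.- q) i ≈ coeffOf p i + - coeffOf q i
      coeff-difference p q = trans (coeff-addP p (K.- q) i) (+-congˡ (coeff-neg q i))

    module Summands (β : Linear) (β-coeff : Homogeneous β) {N} {M : RawMatroid N} (isM : IsMatroid M)
                    (i : ℕ) where
      private
        E : Subset N
        E = ground M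

      D C : Fin N → Carrier
      D e = coeffOf (β (M ∖ₑ e)) i
      C e = coeffOf (β (M /ₑ e)) i

      t u : ℕ → Fin N → Carrier
      t r e = [ lookup E e ]· ([ isUniform r 1 (M /ˢ (E ─ ⁅ e ⁆)) ]· D e)
      u r e = [ lookup E e ]· ([ isUniform r 1 (M ∣ˢ ⁅ e ⁆) ]· C e)

      coeff-β⊛δ : ∀ r → coeffOf ((β ⊛ δ r) M) i ≈ sum (t r)
      coeff-β⊛δ r = trans (⊛-δʳ r β M i)
        (coeff-sum-indicators (lookup E) (λ e → isUniform r 1 (M /ˢ (E ─ ⁅ e ⁆))) (λ e → β (M ∖ₑ e)) i)

      coeff-δ⊛β : ∀ r → coeffOf ((δ r ⊛ β) M) i ≈ sum (u r)
      coeff-δ⊛β r = trans (⊛-δˡ r β M i)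
        (coeff-sum-indicators (lookup E) (λ e → isUniform r 1 (M ∣ˢ ⁅ e ⁆)) (λ e → β (M /ₑ e)) i)

      element : ∀ {e} → e ∈ E →
        combination ([ isUniform 1 1 (M /ˢ (E ─ ⁅ e ⁆)) ]· D e) ([ isUniform 0 1 (M ∣ˢ ⁅ e ⁆) ]· C e)
                    ([ isUniform 1 1 (M ∣ˢ ⁅ e ⁆) ]· C e) ([ isUniform 0 1 (M /ˢ (E ─ ⁅ e ⁆)) ]· D e)
          ≈ [ suc i ≡ᵇ ∣ E ∣ ]· Q M
      element {e} e∈E = begin
        combination _ _ _ _
          ≈⟨ combination-cong (by-test (≡.trans (isUniform-contraction 1) (⇔ᵇ-true col)))
                              (by-test (≡.trans (isUniform-restriction 0) (⇔ᵇ-false ind)))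
                              (by-test (≡.trans (isUniform-restriction 1) (⇔ᵇ-true ind)))
                              (by-test (≡.trans (isUniform-contraction 0) (⇔ᵇ-false col))) ⟩
        combination ([ col ]· D e) ([ not ind ]· C e) ([ ind ]· C e) ([ not col ]· D e)
          ≈⟨ combination-split col ind (D e) (C e) (coloopTest⇒indep isM e∈E) C≈D ⟩
        recurrence col ind (D e) (C e)
          ≈⟨ recurrence-cong col ind (β-coeff (M ∖ₑ e) i) (β-coeff (M /ₑ e) i) ⟩
        recurrence col ind ([ w ]· Q (M ∖ₑ e)) ([ w ]· Q (M /ₑ e))
          ≈⟨ recurrence-[]· col ind w _ _ ⟩
        [ w ]· recurrence col ind (Q (M ∖ₑ e)) (Q (M /ₑ e))
          ≈⟨ []·-cong w (λ _ → Q-recurrence isM e∈E) ⟨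
        [ w ]· Q M
          ≡⟨ ≡.cong (λ n → [ suc i ≡ᵇ n ]· Q M) (∣─⁅⁆∣ E e∈E) ⟨
        [ suc i ≡ᵇ ∣ E ∣ ]· Q M ∎
        where
        open Element isM e∈E using (isUniform-contraction; isUniform-restriction)
        col ind w : Bool
        col = coloopTest M e
        ind = indep M ⁅ e ⁆
        w = i ≡ᵇ ∣ E ─ ⁅ e ⁆ ∣
        by-test : ∀ {b b′ v} → b ≡ b′ → [ b ]· v ≈ [ b′ ]· v
        by-test ≡.refl = refl
        C≈D : T col ⊎ ¬ T ind → C e ≈ D e
        C≈D coloop⊎loop = begin
          C e                  ≈⟨ β-coeff (M /ₑ e) i ⟩
          [ w ]· Q (M /ₑ e)    ≈⟨ []·-cong w (λ _ → Q-contraction≈deletion isM e∈E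
                                                     (loop⊎coloop coloop⊎loop)) ⟩
          [ w ]· Q (M ∖ₑ e)    ≈⟨ β-coeff (M ∖ₑ e) i ⟨
          D e                  ∎
          where
          loop⊎coloop : T col ⊎ ¬ T ind → IsLoop M e ⊎ IsColoop M e
          loop⊎coloop (inj₁ h)   = inj₂ (Element.coloopTest⇒coloop isM e∈E h)
          loop⊎coloop (inj₂ ¬ie) = inj₁ (e∈E , ¬ie)

      element-term : ∀ e → combination (t 1 e) (u 0 e) (u 1 e) (t 0 e) ≈
                           [ lookup E e ]· ([ suc i ≡ᵇ ∣ E ∣ ]· Q M)
      element-term e = trans (combination-[]· (lookup E e) _ _ _ _)
                             ([]·-cong (lookup E e) (λ E[e] → element (lookup⇒[]= e E (T⇒≡true E[e]))))

      -- the left-hand side: (i + 1) Q_M if |E| = i + 1, which is |E| Q_M, else 0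
      coeff-lhs : coeffOf (deriv R (β M)) i ≈ sum (λ e → [ lookup E e ]· ([ suc i ≡ᵇ ∣ E ∣ ]· Q M))
      coeff-lhs = begin
        coeffOf (deriv R (β M)) i                       ≈⟨ coeff-deriv (β M) i ⟩
        times R (suc i) (coeffOf (β M) (suc i))          ≈⟨ times-cong (suc i) (β-coeff M (suc i)) ⟩
        times R (suc i) ([ suc i ≡ᵇ ∣ E ∣ ]· Q M)        ≈⟨ times-≡ᵇ (suc i) ∣ E ∣ (Q M) ⟩
        times R ∣ E ∣ ([ suc i ≡ᵇ ∣ E ∣ ]· Q M)          ≈⟨ times-count E _ ⟩
        sum (λ e → [ lookup E e ]· ([ suc i ≡ᵇ ∣ E ∣ ]· Q M)) ∎

    derivative-formula : (β : Linear) → Homogeneous β →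
      ∀ {N} (M : RawMatroid N) → IsMatroid M → deriv R (β M) K.≈ rhs β M
    derivative-formula β β-coeff M isM i = begin
      coeffOf (deriv R (β M)) i
        ≈⟨ coeff-lhs ⟩
      sum (λ e → [ lookup (ground M) e ]· ([ suc i ≡ᵇ ∣ ground M ∣ ]· Q M))
        ≈⟨ sum-cong-≋ element-term ⟨
      sum (λ e → combination (t 1 e) (u 0 e) (u 1 e) (t 0 e))
        ≈⟨ combination-∑ (t 1) (u 0) (u 1) (t 0) ⟨
      combination (sum (t 1)) (sum (u 0)) (sum (u 1)) (sum (t 0))
        ≈⟨ combination-cong (coeff-β⊛δ 1) (coeff-δ⊛β 0) (coeff-δ⊛β 1) (coeff-β⊛δ 0) ⟨
      combination (coeffOf ((β ⊛ δ 1) M) i) (coeffOf ((δ 0 ⊛ β) M) i)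
                  (coeffOf ((δ 1 ⊛ β) M) i) (coeffOf ((β ⊛ δ 0) M) i)
        ≈⟨ coeff-rhs β M i ⟨
      coeffOf (rhs β M) i ∎
      where open Summands β β-coeff isM i

module _ {c ℓ} (k : Field c ℓ) where
  open Over k

  R₄-laws : IsNARing R₄
  R₄-laws = Polynomials.polyLaws R₃ (Polynomials.polyLaws R₂ (Polynomials.polyLaws R₁
              (Polynomials.polyLaws R₀ (commutativeRing⇒IsNARing (Field.commutativeRing k)))))

  open NARingProperties R₄ R₄-laws
  open Polynomials R₄ R₄-laws using (coeffOf; _⋆_; coeff-mulP; ⋆-varˡ; ⋆-varˡ-zero; coeff-mulConst)

  coeff-s^ : ∀ n j → coeffOf (s ^K n) j ≈ [ j ≡ᵇ n ]· 1#
  coeff-s^ zero    zero    = refl {1#}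
  coeff-s^ zero    (suc j) = refl {0#}
  coeff-s^ (suc n) zero    = begin
    coeffOf (s ^K suc n) zero             ≈⟨ coeff-mulP s (s ^K n) zero ⟩
    (coeffOf s ⋆ coeffOf (s ^K n)) zero    ≈⟨ ⋆-varˡ-zero (coeffOf (s ^K n)) ⟩
    0#                                     ∎
  coeff-s^ (suc n) (suc j) = begin
    coeffOf (s ^K suc n) (suc j)           ≈⟨ coeff-mulP s (s ^K n) (suc j) ⟩
    (coeffOf s ⋆ coeffOf (s ^K n)) (suc j) ≈⟨ ⋆-varˡ (coeffOf (s ^K n)) j ⟩
    coeffOf (s ^K n) j                     ≈⟨ coeff-s^ n j ⟩
    [ j ≡ᵇ n ]· 1#                         ∎

  β-coeff : ∀ (Q : ∀ {N} → RawMatroid N → Kxyab) {N} (M : RawMatroid N) j →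
            coeffOf (β Q M) j ≈ [ j ≡ᵇ ∣ ground M ∣ ]· Q M
  β-coeff Q M j = begin
    coeffOf (β Q M) j                  ≈⟨ coeff-mulConst (s ^K ∣ ground M ∣) (Q M) j ⟩
    coeffOf (s ^K ∣ ground M ∣) j * Q M ≈⟨ *-congʳ {Q M} {coeffOf (s ^K ∣ ground M ∣) j} {[ j ≡ᵇ ∣ ground M ∣ ]· 1#}
                                                    (coeff-s^ ∣ ground M ∣ j) ⟩
    ([ j ≡ᵇ ∣ ground M ∣ ]· 1#) * Q M   ≈⟨ indicator-* (j ≡ᵇ ∣ ground M ∣) (Q M) ⟩
    [ j ≡ᵇ ∣ ground M ∣ ]· Q M          ∎

mainTheorem7 :
    ∀ {c ℓ} (k : Field c ℓ) → CharZero k →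
    let open Over k in
    (Q : ∀ {N} → RawMatroid N → Kxyab) →
    -- Q depends only on the isomorphism class
    (∀ {N N'} (M : RawMatroid N) (M' : RawMatroid N') →
       IsMatroid M → IsMatroid M' → Iso M M' → Q M ≈xyab Q M') →
    -- (i)
    (∀ {N₁ N₂} (M₁ : RawMatroid N₁) (M₂ : RawMatroid N₂) →
       IsMatroid M₁ → IsMatroid M₂ → Q (M₁ ⊕ M₂) ≈xyab (Q M₁ *xyab Q M₂)) →
    Q emptyMatroid ≈xyab 1xyab →
    -- (ii)
    (∀ {N} (M : RawMatroid N) (e : Fin N) → IsMatroid M → IsColoop M e →
       Q M ≈xyab (x *xyab Q (M ∖ₑ e))) →
    -- (iii)
    (∀ {N} (M : RawMatroid N) (e : Fin N) → IsMatroid M → IsLoop M e →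
       Q M ≈xyab (y *xyab Q (M /ₑ e))) →
    -- (iv)
    (∀ {N} (M : RawMatroid N) (e : Fin N) → IsMatroid M → e ∈ ground M →
       ¬ IsLoop M e → ¬ IsColoop M e →
       Q M ≈xyab ((a *xyab Q (M ∖ₑ e)) +xyab (b *xyab Q (M /ₑ e)))) →
    -- conclusion
    ∀ {N} (M : RawMatroid N) → IsMatroid M →
      d/ds (β Q M) ≈K
        ((((↑ x *K (β Q ⊛ δcoloop) M)
           +K (↑ y *K (δloop ⊛ β Q) M))
           +K (↑ b *K [ δcoloop , β Q ]⊛ M))
           -K (↑ a *K [ δloop , β Q ]⊛ M))
mainTheorem7 k _ Q Q-iso _ _ Q-coloop Q-loop Q-ordinary =
  DerivativeFormula.derivative-formula R₄ (R₄-laws k) x y a b Q Q-iso Q-coloop Q-loop Q-ordinary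
    (β Q) (β-coeff k Q)
  where open Over k
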